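{- Let $x\in \Sigma^n$. For all $i,j\in [0\,..\, n]$ with $i\le j$, we have $\mathcal{D}(i,j)\le \mathrm{GD}(i,j) \le 3 \mathcal{D}(i,j)-h(i)-h(j)+2h(i,j)$.
   Context: $\Sigma$ is the disjoint union of opening parentheses $T$ and closing parentheses $\overline{T}$ with a bijection $a\mapsto\overline{a}$; $\mathsf{Dyck}(\Sigma)$ is generated by $S\to SS\mid\varnothing\mid aS\overline{a}$ ($a\in T$); $\mathsf{dyck}(y)$ is the minimum number of insertions, deletions and substitutions turning $y$ into a string of $\mathsf{Dyck}(\Sigma)$. For $x\in\Sigma^n$ and $0\le i\le j\le n$, $x(i..j]=x[i+1]\cdots x[j]$ and $\mathcal{D}(i,j)=\mathsf{dyck}(x(i..j])$. The height is $h(i)=|\{j\in[1..i]:x[j]\in T\}|-|\{j\in[1..i]:x[j]\in\overline{T}\}|$ and $h(i,j)=\min_{k\in[i..j]}h(k)$. A valley is a position $v\in[1..n)$ with $h(v-1)>h(v)<h(v+1)$; $K\subseteq[0..n]$ is the set of positions at distance $0$ or $1$ from a valley. $\mathrm{GD}$ is defined by $\mathrm{GD}(i,i)=0$, $\mathrm{GD}(i,i+1)=1$, and for $j-i\ge2$, $\mathrm{GD}(i,j)$ is the minimum of $\mathrm{GD}(i,k)+\mathrm{GD}(k,j)$ over $k\in(i..j)\cap(K\cup\{i+1,i+2,j-2,j-1\})$ and, only if $h(i+1,j-1)>h(i,j)$, of $\mathrm{GD}(i+1,j-1)+\mathsf{dyck}(x[i+1]x[j])$. -}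

module Defs where

open import Data.Nat using (ℕ; zero; suc; _+_; _∸_; _≤_; _<_; _⊓_; _≤?_; _≟_)
open import Data.Integer as ℤ using (ℤ; +_; -[1+_])
open import Data.List using (List; []; _∷_; _++_; take; drop; length; map; foldr; filter; upTo)
open import Data.Bool using (Bool; true; false; _∧_; _∨_; if_then_else_)
open import Data.Product using (Σ; ∃; _×_; _,_)
open import Relation.Nullary.Decidable using (⌊_⌋)

-- Alphabet Σ = T ⊎ T̄ : an opening parenthesis  open a  and its
-- matching closing parenthesis  close a  (the bijection a ↦ ā).

data Paren (T : Set) : Set where
  open′  : T → Paren T
  close′ : T → Paren T

module _ {T : Set} where

  data Dyck : List (Paren T) → Set where
    emp  : Dyck []
    cat  : ∀ {u v} → Dyck u → Dyck v → Dyck (u ++ v)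
    wrap : ∀ a {u} → Dyck u → Dyck (open′ a ∷ u ++ close′ a ∷ [])

  data Edit : List (Paren T) → List (Paren T) → ℕ → Set where
    nil   : Edit [] [] 0
    match : ∀ {a xs ys k} → Edit xs ys k → Edit (a ∷ xs) (a ∷ ys) k
    subst : ∀ {a b xs ys k} → Edit xs ys k → Edit (a ∷ xs) (b ∷ ys) (suc k)
    del   : ∀ {a xs ys k} → Edit xs ys k → Edit (a ∷ xs) ys (suc k)
    ins   : ∀ {b xs ys k} → Edit xs ys k → Edit xs (b ∷ ys) (suc k)

  IsDyckDist : List (Paren T) → ℕ → Set
  IsDyckDist y d =
    (∃ λ w → Dyck w × Edit y w d) ×
    (∀ w k → Dyck w → Edit y w k → d ≤ k)

  -- Substring x(i..j] = x[i+1] ⋯ x[j]  (x[1] is the head of the list)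

  sub : List (Paren T) → ℕ → ℕ → List (Paren T)
  sub x i j = take (j ∸ i) (drop i x)

  sign : Paren T → ℤ
  sign (open′ _)  = + 1
  sign (close′ _) = -[1+ 0 ]

  sumℤ : List ℤ → ℤ
  sumℤ = foldr ℤ._+_ (+ 0)

  h : List (Paren T) → ℕ → ℤ
  h x i = sumℤ (map sign (take i x))

  hminAux : List (Paren T) → ℕ → ℕ → ℤ
  hminAux x i zero    = h x i
  hminAux x i (suc d) = hminAux x i d ℤ.⊓ h x (i + suc d)

  hmin : List (Paren T) → ℕ → ℕ → ℤ
  hmin x i j = hminAux x i (j ∸ i)

  isValley : List (Paren T) → ℕ → Bool
  isValley x zero    = false
  isValley x (suc u) =
    ⌊ suc u <? length x ⌋ ∧ ⌊ h x (suc u) ℤ.<? h x u ⌋ ∧ ⌊ h x (suc u) ℤ.<? h x (suc (suc u)) ⌋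
    where open import Data.Nat using (_<?_)

  inK : List (Paren T) → ℕ → Bool
  inK x p = ⌊ p ≤? length x ⌋ ∧ (prev p ∨ isValley x p ∨ isValley x (suc p))
    where
    prev : ℕ → Bool
    prev zero    = false
    prev (suc q) = isValley x q

  range : ℕ → ℕ → List ℕ
  range a b = map (λ t → a + t) (upTo (b ∸ a))

  -- minimum of a list (only applied to non-empty lists)
  minOver : List ℕ → ℕ
  minOver []       = 0
  minOver (a ∷ as) = foldr _⊓_ a as

  eqb : ℕ → ℕ → Bool
  eqb m n = ⌊ m ≟ n ⌋

  splits : List (Paren T) → ℕ → ℕ → List ℕ
  splits x i j =
    filter (λ k → Data.Bool.T? (inK x k ∨ eqb k (suc i) ∨ eqb k (suc (suc i))
                                  ∨ eqb k (j ∸ 2) ∨ eqb k (j ∸ 1)))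
           (range (suc i) j)
    where import Data.Bool

  -- GD with a fuel argument; fuel ≥ j − i suffices since every recursive
  -- call is on a strictly shorter interval.  dk plays the role of dyck.
  GDf : List (Paren T) → (List (Paren T) → ℕ) → ℕ → ℕ → ℕ → ℕ
  GDf x dk zero    i j = 0
  GDf x dk (suc f) i j with j ∸ i
  ... | zero        = 0
  ... | suc zero    = 1
  ... | suc (suc _) =
    let splitVal = minOver (map (λ k → GDf x dk f i k + GDf x dk f k j) (splits x i j))
        nestVal  = GDf x dk f (suc i) (j ∸ 1) + dk (sub x i (suc i) ++ sub x (j ∸ 1) j)
    in if ⌊ hmin x i j ℤ.<? hmin x (suc i) (j ∸ 1) ⌋
       then splitVal ⊓ nestVal
       else splitVal

  GD : List (Paren T) → (List (Paren T) → ℕ) → ℕ → ℕ → ℕ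
  GD x dk i j = GDf x dk (j ∸ i) i j

-- Both bounds are proved through weighted parses of x(i..j]: every letter is either
-- deleted, at cost 1, or paired with a later letter, at the cost of repairing that pair
-- of letters into a Dyck word.  A parse yields an edit into a Dyck word of the same cost,
-- and conversely any edit into a Dyck word yields a parse of no greater cost.
--
-- Lower bound: the recursion defining GD is realised by a parse of cost at most GD.
--
-- Upper bound: any parse can be rebuilt, without increasing its cost, so that its root
-- is either a split at an allowed point or a pair enclosing the whole interval.  A split
-- point outside K ∪ {i+1, i+2, j−2, j−1} has two equal brackets on one side and can slide
-- past one or both of them: re-parsing that side without them saves at least one, which
-- pays for deleting the one letter or pairing the two.  Induction on this normal form shows
-- GD(i,j) + h(i) + h(j) − 2h(i,j) ≤ 3·cost: the height term is superadditive at splits,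
-- and at an enclosing pair of cost e either GD grows by e and the height term by at most
-- 2e, or GD grows by 2 (both ends deleted) and the height term by at most 2e − 2.

module Submission where

open import Defs
open import Data.Bool using (Bool; _∨_; _∧_; T?; if_then_else_)
import Data.Bool as Bool
open import Data.Empty using (⊥; ⊥-elim)
open import Data.Integer as ℤ using (ℤ; +_; -[1+_])
import Data.Integer.Properties as ℤP
import Data.Integer.Tactic.RingSolver as ℤ-Solver
open import Data.List using (List; []; _∷_; _++_; [_]; length; take; drop; map; foldr)
open import Data.List.Membership.Propositional using (_∈_)
open import Data.List.Membership.Propositional.Properties using (∈-filter⁺; ∈-filter⁻; ∈-map⁺; ∈-map⁻; ∈-upTo⁺; ∈-upTo⁻)
open import Data.List.Properties
  using (map-cong-local; ++-identityʳ; ∷ʳ-injectiveʳ; ∷-injectiveʳ; ∷-injectiveˡ; length-take; length-drop; take-[]; length-++; drop-drop)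
import Data.List.Relation.Unary.All as All
open import Data.List.Relation.Unary.Any as Any using (here; there)
open import Data.Nat using (ℕ; zero; suc; _+_; _*_; _∸_; _≤_; _<_; _⊓_; z≤n; s≤s; _<?_; _≤?_)
open import Data.Nat.Induction using (<-wellFounded)
open import Data.Nat.Properties
open import Data.Nat.Tactic.RingSolver using (solve-∀)
open import Data.Product using (∃-syntax; _×_; _,_; proj₁; proj₂)
open import Data.Sum using (_⊎_; inj₁; inj₂)
open import Function.Base using (_∘_; _$_; case_of_)
open import Induction.WellFounded using (Acc; acc)
open import Relation.Binary.PropositionalEquality using (_≡_; _≢_; refl; sym; trans; cong; cong₂; module ≡-Reasoning)
import Relation.Binary.PropositionalEquality as ≡
open import Relation.Nullary using (¬_)
open import Relation.Nullary.Decidable using (Dec; yes; no; ⌊_⌋; fromWitness; map′)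

private
  3+i≤k-unless-near : ∀ {i k} → i < k → k ≢ suc i → k ≢ suc (suc i) → suc (suc (suc i)) ≤ k
  3+i≤k-unless-near {i} {k} i<k k≢1+i k≢2+i with m≤n⇒m<n∨m≡n i<k
  ... | inj₂ refl = ⊥-elim (k≢1+i refl)
  ... | inj₁ 1+i<k with m≤n⇒m<n∨m≡n 1+i<k
  ...   | inj₂ refl = ⊥-elim (k≢2+i refl)
  ...   | inj₁ 2+i<k = 2+i<k

  3+k≤j-unless-near : ∀ {k j} → k < j → k ≢ j ∸ 1 → k ≢ j ∸ 2 → suc (suc (suc k)) ≤ j
  3+k≤j-unless-near {k} {suc j} (s≤s k≤j) k≢j-1 k≢j-2 with m≤n⇒m<n∨m≡n k≤j
  ... | inj₂ refl = ⊥-elim (k≢j-1 refl)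
  ... | inj₁ (s≤s k<j) with m≤n⇒m<n∨m≡n k<j
  ...   | inj₂ refl = ⊥-elim (k≢j-2 refl)
  ...   | inj₁ k+1<j = s≤s (s≤s k+1<j)

  pay-one-left : ∀ {c₀ c′ c″ c} → suc c₀ ≤ c′ → c′ + c″ ≤ c → c₀ + suc c″ ≤ c
  pay-one-left {c₀} {c″ = c″} c₀<c′ le = ≤-trans (≤-reflexive (+-suc c₀ c″)) (≤-trans (+-monoˡ-≤ c″ c₀<c′) le)

  pay-one-right : ∀ {c₀ c′ c″ c} → suc c₀ ≤ c″ → c′ + c″ ≤ c → (c′ + 1) + c₀ ≤ c
  pay-one-right {c₀} {c′} c₀<c″ le = ≤-trans (≤-reflexive (+-assoc c′ 1 c₀)) (≤-trans (+-monoʳ-≤ c′ c₀<c″) le)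

  ∸-suc≤ : ∀ j k {b} → j ∸ k ≤ suc b → j ∸ suc k ≤ b
  ∸-suc≤ j k j∸k≤ = ≤-trans (≤-reflexive (sym (pred[m∸n]≡m∸[1+n] j k))) (pred-mono-≤ j∸k≤)

  left-part≤ : ∀ {i k j f} → i < k → k < j → j ∸ i ≤ suc f → k ∸ i ≤ f
  left-part≤ i<k k<j j∸i≤ = ≤-pred (≤-trans (∸-monoˡ-< k<j (<⇒≤ i<k)) j∸i≤)

  right-part≤ : ∀ {i k j f} → i < k → k < j → j ∸ i ≤ suc f → j ∸ k ≤ f
  right-part≤ i<k k<j j∸i≤ = ≤-pred (≤-trans (∸-monoʳ-< i<k (<⇒≤ k<j)) j∸i≤)

  inner-length : ∀ i j → j ∸ 1 ∸ suc i ≡ j ∸ i ∸ 2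
  inner-length i j = begin
    j ∸ 1 ∸ suc i       ≡⟨ ∸-+-assoc j 1 (suc i) ⟩
    j ∸ suc (suc i)     ≡⟨ cong (j ∸_) (+-comm 2 i) ⟩
    j ∸ (i + 2)         ≡⟨ ∸-+-assoc j i 2 ⟨
    j ∸ i ∸ 2           ∎
    where open ≡-Reasoning

  inner-part≤ : ∀ {i j f} → j ∸ i ≤ suc f → j ∸ 1 ∸ suc i ≤ f
  inner-part≤ {i} {j} {f} j∸i≤ = ≤-trans (≤-reflexive (inner-length i j)) (≤-trans (∸-monoˡ-≤ 2 j∸i≤) (m∸n≤m f 1))

  2≤∸ : ∀ {i j} → suc i < j → 2 ≤ j ∸ i
  2≤∸ {i} = m+n≤o⇒m≤o∸n 2 {i}

  inner< : ∀ {i j} → i < j → j ∸ suc i < suc j ∸ i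
  inner< {i} {j} i<j = ≤-trans (s≤s (∸-monoʳ-≤ j (n≤1+n i))) (≤-reflexive (sym (+-∸-assoc 1 (<⇒≤ i<j))))

  +-mono-middle : ∀ ℓ₁ c ℓ₃ k₁ k₃ → ℓ₁ + ℓ₃ ≤ k₁ + k₃ → ℓ₁ + (c + ℓ₃) ≤ k₁ + (c + k₃)
  +-mono-middle ℓ₁ c ℓ₃ k₁ k₃ le = begin
    ℓ₁ + (c + ℓ₃)   ≡⟨ swap ℓ₁ c ℓ₃ ⟩
    c + (ℓ₁ + ℓ₃)   ≤⟨ +-monoʳ-≤ c le ⟩
    c + (k₁ + k₃)   ≡⟨ swap c k₁ k₃ ⟩
    k₁ + (c + k₃)   ∎
    where
      open ≤-Reasoning
      swap : ∀ a b d → a + (b + d) ≡ b + (a + d)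
      swap = solve-∀

  enclose-cost : ∀ a₁ a₂ c b₁ b₂ e d₁ d₃ k₁ k₃ → e ≤ d₁ + d₃ → a₁ + a₂ + d₁ ≤ k₁ → b₁ + b₂ + d₃ ≤ k₃ →
                 a₁ + ((a₂ + (c + b₁) + e) + b₂) ≤ k₁ + (c + k₃)
  enclose-cost a₁ a₂ c b₁ b₂ e d₁ d₃ k₁ k₃ e≤ ≤k₁ ≤k₃ = begin
    a₁ + ((a₂ + (c + b₁) + e) + b₂)               ≤⟨ +-monoʳ-≤ a₁ (+-monoˡ-≤ b₂ (+-monoʳ-≤ (a₂ + (c + b₁)) e≤)) ⟩
    a₁ + ((a₂ + (c + b₁) + (d₁ + d₃)) + b₂)       ≡⟨ regroup a₁ a₂ c b₁ b₂ d₁ d₃ ⟩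
    (a₁ + a₂ + d₁) + (c + (b₁ + b₂ + d₃))         ≤⟨ +-mono-≤ ≤k₁ (+-monoʳ-≤ c ≤k₃) ⟩
    k₁ + (c + k₃)                                 ∎
    where
      open ≤-Reasoning
      regroup : ∀ a₁ a₂ c b₁ b₂ d₁ d₃ →
                a₁ + ((a₂ + (c + b₁) + (d₁ + d₃)) + b₂) ≡ (a₁ + a₂ + d₁) + (c + (b₁ + b₂ + d₃))
      regroup = solve-∀

  exchange-cost-trailing : ∀ c₁ c₂ d₁ d₂ e e′ e₃ c → c₁ + c₂ + e ≤ c → d₁ + d₂ + e′ ≤ c₂ → suc e₃ ≤ e + e′ →
                     suc (c₁ + ((d₁ + e₃) + d₂)) ≤ c
  exchange-cost-trailing c₁ c₂ d₁ d₂ e e′ e₃ c ≤c ≤c₂ e₃< = begin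
    suc (c₁ + ((d₁ + e₃) + d₂))       ≡⟨ shift c₁ d₁ e₃ d₂ ⟩
    c₁ + ((d₁ + suc e₃) + d₂)         ≤⟨ +-monoʳ-≤ c₁ (+-monoˡ-≤ d₂ (+-monoʳ-≤ d₁ e₃<)) ⟩
    c₁ + ((d₁ + (e + e′)) + d₂)       ≡⟨ regroup c₁ d₁ d₂ e e′ ⟩
    c₁ + (d₁ + d₂ + e′) + e           ≤⟨ +-monoˡ-≤ e (+-monoʳ-≤ c₁ ≤c₂) ⟩
    c₁ + c₂ + e                       ≤⟨ ≤c ⟩
    c                                 ∎
    where
      open ≤-Reasoning
      shift : ∀ c₁ d₁ e₃ d₂ → suc (c₁ + ((d₁ + e₃) + d₂)) ≡ c₁ + ((d₁ + suc e₃) + d₂)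
      shift = solve-∀
      regroup : ∀ c₁ d₁ d₂ e e′ → c₁ + ((d₁ + (e + e′)) + d₂) ≡ c₁ + (d₁ + d₂ + e′) + e
      regroup = solve-∀

  exchange-cost-leading : ∀ c₁ c₂ d₁ d₂ e e′ e₃ c → c₁ + e + c₂ ≤ c → d₁ + e′ + d₂ ≤ c₁ → suc e₃ ≤ e + e′ →
                    suc (d₁ + ((d₂ + e₃) + c₂)) ≤ c
  exchange-cost-leading c₁ c₂ d₁ d₂ e e′ e₃ c ≤c ≤c₁ e₃< = begin
    suc (d₁ + ((d₂ + e₃) + c₂))       ≡⟨ shift d₁ d₂ e₃ c₂ ⟩
    d₁ + ((d₂ + suc e₃) + c₂)         ≤⟨ +-monoʳ-≤ d₁ (+-monoˡ-≤ c₂ (+-monoʳ-≤ d₂ e₃<)) ⟩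
    d₁ + ((d₂ + (e + e′)) + c₂)       ≡⟨ regroup d₁ d₂ c₂ e e′ ⟩
    (d₁ + e′ + d₂) + e + c₂           ≤⟨ +-monoˡ-≤ c₂ (+-monoˡ-≤ e ≤c₁) ⟩
    c₁ + e + c₂                       ≤⟨ ≤c ⟩
    c                                 ∎
    where
      open ≤-Reasoning
      shift : ∀ d₁ d₂ e₃ c₂ → suc (d₁ + ((d₂ + e₃) + c₂)) ≡ d₁ + ((d₂ + suc e₃) + c₂)
      shift = solve-∀
      regroup : ∀ d₁ d₂ c₂ e e′ → d₁ + ((d₂ + (e + e′)) + c₂) ≡ (d₁ + e′ + d₂) + e + c₂
      regroup = solve-∀

  ≤-by-difference : ∀ {X Y} D → Y ℤ.- X ≡ D → + 0 ℤ.≤ D → X ℤ.≤ Y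
  ≤-by-difference D eq 0≤D = ℤP.0≤i-j⇒j≤i (≡.subst (+ 0 ℤ.≤_) (sym eq) 0≤D)

  0≤-double : ∀ {d} → + 0 ℤ.≤ d → + 0 ℤ.≤ d ℤ.+ d
  0≤-double 0≤d = ℤP.+-mono-≤ 0≤d 0≤d

  +-≤-⊓-+ : ∀ {a b c} → a ℤ.≤ c → b ℤ.≤ c → a ℤ.+ b ℤ.≤ (a ℤ.⊓ b) ℤ.+ c
  +-≤-⊓-+ {a} {b} {c} a≤c b≤c with ℤP.⊓-sel a b
  ... | inj₁ eq rewrite eq = ℤP.+-monoʳ-≤ a b≤c
  ... | inj₂ eq rewrite eq = ≡.subst (ℤ._≤ b ℤ.+ c) (ℤP.+-comm b a) (ℤP.+-monoʳ-≤ b a≤c)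

  ℕ≤⇒ℤ≤ : ∀ {m n k} → m ≤ n + k → + m ℤ.≤ + n ℤ.+ + k
  ℕ≤⇒ℤ≤ {m} {n} {k} m≤n+k = ≡.subst (+ m ℤ.≤_) (ℤP.pos-+ n k) (ℤ.+≤+ m≤n+k)

  3*-mono : ∀ {a b c} → a + b ≤ c → + (3 * a) ℤ.+ + (3 * b) ℤ.≤ + (3 * c)
  3*-mono {a} {b} {c} a+b≤c = ≡.subst (ℤ._≤ + (3 * c)) (ℤP.pos-+ (3 * a) (3 * b))
    (ℤ.+≤+ (≤-trans (≤-reflexive (sym (*-distribˡ-+ 3 a b))) (*-monoʳ-≤ 3 a+b≤c)))

  nest-arith-nestable : ∀ G G′ e s d → G ℤ.≤ G′ ℤ.+ + e → d ℤ.≤ + 1 → s ℤ.+ + 2 ℤ.≤ + (e + e) →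
                        G ℤ.+ (s ℤ.+ (d ℤ.+ d)) ℤ.≤ G′ ℤ.+ + (3 * e)
  nest-arith-nestable G G′ e s d G≤ d≤1 s+2≤ = begin
    G ℤ.+ (s ℤ.+ (d ℤ.+ d))                ≤⟨ ℤP.+-mono-≤ G≤ (ℤP.+-monoʳ-≤ s (ℤP.+-mono-≤ d≤1 d≤1)) ⟩
    G′ ℤ.+ + e ℤ.+ (s ℤ.+ + 2)             ≤⟨ ℤP.+-monoʳ-≤ (G′ ℤ.+ + e) s+2≤ ⟩
    G′ ℤ.+ + e ℤ.+ + (e + e)               ≡⟨ ℤP.+-assoc G′ (+ e) (+ (e + e)) ⟩
    G′ ℤ.+ (+ e ℤ.+ + (e + e))             ≡⟨ cong (λ z → G′ ℤ.+ z) (trans (sym (ℤP.pos-+ e (e + e))) (cong +_ (three e))) ⟩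
    G′ ℤ.+ + (3 * e)                       ∎
    where
      open ℤP.≤-Reasoning
      three : ∀ e → e + (e + e) ≡ 3 * e
      three = solve-∀

  nest-arith-flat : ∀ G G′ e s d → G ℤ.≤ + 2 ℤ.+ G′ → d ℤ.≤ + 0 → s ℤ.+ + 2 ℤ.≤ + (e + e) →
                    G ℤ.+ (s ℤ.+ (d ℤ.+ d)) ℤ.≤ G′ ℤ.+ + (3 * e)
  nest-arith-flat G G′ e s d G≤ d≤0 s+2≤ = begin
    G ℤ.+ (s ℤ.+ (d ℤ.+ d))                ≤⟨ ℤP.+-mono-≤ G≤ (ℤP.+-monoʳ-≤ s (ℤP.+-mono-≤ d≤0 d≤0)) ⟩
    + 2 ℤ.+ G′ ℤ.+ (s ℤ.+ + 0)             ≡⟨ identity G′ s ⟩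
    G′ ℤ.+ (s ℤ.+ + 2)                     ≤⟨ ℤP.+-monoʳ-≤ G′ (ℤP.≤-trans s+2≤ (ℤ.+≤+ 2e≤3e)) ⟩
    G′ ℤ.+ + (3 * e)                       ∎
    where
      open ℤP.≤-Reasoning
      identity : ∀ g s → + 2 ℤ.+ g ℤ.+ (s ℤ.+ + 0) ≡ g ℤ.+ (s ℤ.+ + 2)
      identity = ℤ-Solver.solve-∀
      three : ∀ e → e + (e + e) ≡ 3 * e
      three = solve-∀
      2e≤3e : e + e ≤ 3 * e
      2e≤3e = ≤-trans (m≤n+m (e + e) e) (≤-reflexive (three e))

  isolate-GD : ∀ {G hi hj μ c D} → G ℤ.+ (hi ℤ.+ hj ℤ.- (μ ℤ.+ μ)) ℤ.≤ + (3 * c) → c ≤ D →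
               G ℤ.≤ + 3 ℤ.* + D ℤ.- hi ℤ.- hj ℤ.+ + 2 ℤ.* μ
  isolate-GD {G} {hi} {hj} {μ} {c} {D} bound c≤D =
    ≤-by-difference _ (identity G (+ D) hi hj μ) (ℤP.i≤j⇒0≤j-i (ℤP.≤-trans bound 3c≤3D))
    where
      3c≤3D : + (3 * c) ℤ.≤ + 3 ℤ.* + D
      3c≤3D = ℤP.≤-trans (ℤ.+≤+ (*-monoʳ-≤ 3 c≤D)) (ℤP.≤-reflexive (ℤP.pos-* 3 D))
      identity : ∀ G D hi hj μ → + 3 ℤ.* D ℤ.- hi ℤ.- hj ℤ.+ + 2 ℤ.* μ ℤ.- G ≡ + 3 ℤ.* D ℤ.- (G ℤ.+ (hi ℤ.+ hj ℤ.- (μ ℤ.+ μ)))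
      identity = ℤ-Solver.solve-∀

  ∸-split : ∀ {i k j} → i ≤ k → k ≤ j → j ∸ i ≡ (k ∸ i) + (j ∸ k)
  ∸-split {i} {k} {j} i≤k k≤j = begin
    j ∸ i               ≡⟨ cong (_∸ i) (m+[n∸m]≡n k≤j) ⟨
    (k + (j ∸ k)) ∸ i   ≡⟨ +-∸-comm (j ∸ k) i≤k ⟩
    (k ∸ i) + (j ∸ k)   ∎
    where open ≡-Reasoning

  suc∸≡1 : ∀ i → suc i ∸ i ≡ 1
  suc∸≡1 zero    = refl
  suc∸≡1 (suc i) = suc∸≡1 i

  take-+ : ∀ {A : Set} m n (u : List A) → take (m + n) u ≡ take m u ++ take n (drop m u)
  take-+ zero    n u       = refl
  take-+ (suc m) n []      = sym (take-[] n)
  take-+ (suc m) n (c ∷ u) = cong (c ∷_) (take-+ m n u)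

  ++-cancel-≡length : ∀ {A : Set} (u v u′ v′ : List A) → u ++ v ≡ u′ ++ v′ → length u ≡ length u′ → u ≡ u′ × v ≡ v′
  ++-cancel-≡length []      v []       v′ eq _ = refl , eq
  ++-cancel-≡length (_ ∷ u) v (_ ∷ u′) v′ eq len
    with u≡ , v≡ ← ++-cancel-≡length u v u′ v′ (∷-injectiveʳ eq) (suc-injective len) =
    cong₂ _∷_ (∷-injectiveˡ eq) u≡ , v≡

  foldr-⊓-∈ : ∀ a as → foldr _⊓_ a as ∈ a ∷ as
  foldr-⊓-∈ a []       = here refl
  foldr-⊓-∈ a (b ∷ bs) with ⊓-sel b (foldr _⊓_ a bs) | foldr-⊓-∈ a bs
  ... | inj₁ eq | _        = ≡.subst (_∈ a ∷ b ∷ bs) (sym eq) (there (here refl))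
  ... | inj₂ eq | here p   = here (trans eq p)
  ... | inj₂ eq | there p  = there (there (Any.map (trans eq) p))

  foldr-⊓-≤ : ∀ a as {b} → b ∈ a ∷ as → foldr _⊓_ a as ≤ b
  foldr-⊓-≤ a []       (here refl)         = ≤-refl
  foldr-⊓-≤ a (b ∷ bs) (here refl)         = ≤-trans (m⊓n≤n b _) (foldr-⊓-≤ a bs (here refl))
  foldr-⊓-≤ a (b ∷ bs) (there (here refl)) = m⊓n≤m b _
  foldr-⊓-≤ a (b ∷ bs) (there (there p))   = ≤-trans (m⊓n≤n b _) (foldr-⊓-≤ a bs (there p))

  if-⊓-cong : ∀ {b b′ s s′ n n′} → b ≡ b′ → s ≡ s′ → n ≡ n′ → (if b then s ⊓ n else s) ≡ (if b′ then s′ ⊓ n′ else s′)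
  if-⊓-cong {Bool.true}  refl s≡ n≡ = cong₂ _⊓_ s≡ n≡
  if-⊓-cong {Bool.false} refl s≡ _  = s≡

  if-⊓≤ : ∀ b s n → (if b then s ⊓ n else s) ≤ s
  if-⊓≤ Bool.true  s n = m⊓n≤m s n
  if-⊓≤ Bool.false s n = ≤-refl

  if-true-⊓≤ : ∀ {b} s n → Bool.T b → (if b then s ⊓ n else s) ≤ n
  if-true-⊓≤ {Bool.true} s n _ = m⊓n≤n s n

  if-⊓-sel : ∀ b s n → (if b then s ⊓ n else s) ≡ s ⊎ (if b then s ⊓ n else s) ≡ n
  if-⊓-sel Bool.true  s n = ⊓-sel s n
  if-⊓-sel Bool.false s n = inj₁ refl

  ∧-intro : ∀ {p q} → Bool.T p → Bool.T q → Bool.T (p ∧ q)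
  ∧-intro {Bool.true} _ q = q

  ∨-introˡ : ∀ p q → Bool.T p → Bool.T (p ∨ q)
  ∨-introˡ Bool.true _ _ = _

  ∨-introʳ : ∀ p {q} → Bool.T q → Bool.T (p ∨ q)
  ∨-introʳ Bool.true  _ = _
  ∨-introʳ Bool.false t = t

  ≤+1⇒-1≤ : ∀ {a b} → a ℤ.≤ b ℤ.+ + 1 → a ℤ.- + 1 ℤ.≤ b
  ≤+1⇒-1≤ {a} {b} a≤b+1 = ≤-by-difference _ (identity a b) (ℤP.i≤j⇒0≤j-i a≤b+1)
    where
      identity : ∀ a b → b ℤ.- (a ℤ.- + 1) ≡ b ℤ.+ + 1 ℤ.- a
      identity = ℤ-Solver.solve-∀

  -1≤⇒-≤1 : ∀ {a b} → a ℤ.- + 1 ℤ.≤ b → a ℤ.- b ℤ.≤ + 1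
  -1≤⇒-≤1 {a} {b} a-1≤b = ≤-by-difference _ (identity a b) (ℤP.i≤j⇒0≤j-i a-1≤b)
    where
      identity : ∀ a b → + 1 ℤ.- (a ℤ.- b) ≡ b ℤ.- (a ℤ.- + 1)
      identity = ℤ-Solver.solve-∀

module _ {T : Set} where

  private
    Word : Set
    Word = List (Paren T)

    variable
      u u′ w w′ y : Word
      i j k k′ m c c′ c″ d e e′ : ℕ
      a b : T
      α β γ : Paren T

  edit-++ : Edit u w k → Edit u′ w′ k′ → Edit (u ++ u′) (w ++ w′) (k + k′)
  edit-++ nil       e′ = e′
  edit-++ (match e) e′ = match (edit-++ e e′)
  edit-++ (subst e) e′ = subst (edit-++ e e′)
  edit-++ (del e)   e′ = del (edit-++ e e′)
  edit-++ (ins e)   e′ = ins (edit-++ e e′)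

  record EditSplit (y w₁ w₂ : Word) (k : ℕ) : Set where
    constructor editSplit
    field
      {y₁ y₂} : Word
      {k₁ k₂} : ℕ
      y≡ : y ≡ y₁ ++ y₂
      edit₁ : Edit y₁ w₁ k₁
      edit₂ : Edit y₂ w₂ k₂
      k≡ : k₁ + k₂ ≡ k

  edit-split : ∀ w₁ {w₂} → Edit y (w₁ ++ w₂) k → EditSplit y w₁ w₂ k
  edit-split []       e = editSplit refl nil e refl
  edit-split (_ ∷ w₁) (match e) with editSplit refl e₁ e₂ refl ← edit-split w₁ e = editSplit refl (match e₁) e₂ refl
  edit-split (_ ∷ w₁) (subst e) with editSplit refl e₁ e₂ refl ← edit-split w₁ e = editSplit refl (subst e₁) e₂ refl
  edit-split (b ∷ w₁) (del e)   with editSplit refl e₁ e₂ refl ← edit-split (b ∷ w₁) e = editSplit refl (del e₁) e₂ refl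
  edit-split (_ ∷ w₁) (ins e)   with editSplit refl e₁ e₂ refl ← edit-split w₁ e = editSplit refl (ins e₁) e₂ refl

  edit-length : Edit y w k → length y ≤ length w + k
  edit-length nil = z≤n
  edit-length (match e) = s≤s (edit-length e)
  edit-length {w = _ ∷ w} {k = suc k} (subst e) = s≤s (≤-trans (edit-length e) (+-monoʳ-≤ (length w) (n≤1+n k)))
  edit-length {w = w} {k = suc k} (del e) = ≤-trans (s≤s (edit-length e)) (≤-reflexive (sym (+-suc (length w) k)))
  edit-length {w = _ ∷ w} {k = suc k} (ins e) = ≤-trans (edit-length e) (≤-trans (+-monoʳ-≤ (length w) (n≤1+n k)) (n≤1+n _))

  edit-zero⇒≡ : Edit y w 0 → w ≡ y
  edit-zero⇒≡ nil = refl
  edit-zero⇒≡ (match e) = cong (_ ∷_) (edit-zero⇒≡ e)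

  edit-refl : (y : Word) → Edit y y 0
  edit-refl [] = nil
  edit-refl (_ ∷ y) = match (edit-refl y)

  data Relabel : Paren T → Paren T → ℕ → Set where
    keep   : Relabel α α 0
    change : Relabel α β 1

  record EditToLetter (y : Word) (γ : Paren T) (k : ℕ) : Set where
    constructor survivor
    field
      pre : Word
      {post} : Word
      {kept} : Paren T
      {relabelCost} : ℕ
      y≡ : y ≡ pre ++ kept ∷ post
      relabel : Relabel kept γ relabelCost
      cost≤ : length pre + length post + relabelCost ≤ k

  edit-to-letter : Edit y [ γ ] k → (y ≡ [] × 1 ≤ k) ⊎ EditToLetter y γ k
  edit-to-letter {y = _ ∷ y} (match e) =
    inj₂ (survivor [] refl keep (≤-trans (≤-reflexive (+-identityʳ (length y))) (edit-length e)))
  edit-to-letter {y = _ ∷ y} (subst e) =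
    inj₂ (survivor [] refl change (≤-trans (≤-reflexive (+-comm (length y) 1)) (s≤s (edit-length e))))
  edit-to-letter (del e) with edit-to-letter e
  ... | inj₁ (refl , _) = inj₂ (survivor [] refl change (s≤s z≤n))
  ... | inj₂ (survivor pre refl r le) = inj₂ (survivor (_ ∷ pre) refl r (s≤s le))
  edit-to-letter {y = []} (ins e) = inj₁ (refl , s≤s z≤n)
  edit-to-letter {y = _ ∷ y} {k = suc k} (ins e) =
    inj₂ (survivor [] refl change (≤-trans (≤-reflexive (+-comm (length y) 1)) (≤-trans (edit-length e) (n≤1+n k))))

  dyck-head≢close : Dyck w → w ≡ close′ a ∷ u → ⊥
  dyck-head≢close emp ()
  dyck-head≢close (cat {[]} _ dv) eq = dyck-head≢close dv eq
  dyck-head≢close (cat {_ ∷ _} du _) refl = dyck-head≢close du refl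
  dyck-head≢close (wrap _ _) ()

  ∷ʳ-suffix : (u : Word) {b : Paren T} (v w : Word) → u ++ b ∷ v ≡ w ++ [ γ ] → ∃[ v′ ] b ∷ v ≡ v′ ++ [ γ ]
  ∷ʳ-suffix []      v w       eq = w , eq
  ∷ʳ-suffix (_ ∷ []) v []     ()
  ∷ʳ-suffix (_ ∷ _ ∷ _) v []  ()
  ∷ʳ-suffix (_ ∷ u) v (_ ∷ w) eq = ∷ʳ-suffix u v w (∷-injectiveʳ eq)

  dyck-last≢open : Dyck w → w ≡ u ++ [ open′ a ] → ⊥
  dyck-last≢open {u = []} emp ()
  dyck-last≢open {u = _ ∷ _} emp ()
  dyck-last≢open (cat {u₁} {[]} du _) eq = dyck-last≢open du (trans (sym (++-identityʳ u₁)) eq)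
  dyck-last≢open {u = u} (cat {u₁} {_ ∷ v} _ dv) eq = dyck-last≢open dv (proj₂ (∷ʳ-suffix u₁ v u eq))
  dyck-last≢open {u = u} (wrap c {u₁} _) eq with () ← ∷ʳ-injectiveʳ (open′ c ∷ u₁) u eq

  dyck-pair⇒matched : Dyck w → w ≡ open′ a ∷ close′ b ∷ [] → a ≡ b
  dyck-pair⇒matched (cat {[]} _ dv) eq = dyck-pair⇒matched dv eq
  dyck-pair⇒matched (cat {_ ∷ []} du _) refl = ⊥-elim (dyck-last≢open {u = []} du refl)
  dyck-pair⇒matched (cat {_ ∷ _ ∷ []} {[]} du _) refl = dyck-pair⇒matched du refl
  dyck-pair⇒matched (cat {_ ∷ _ ∷ []} {_ ∷ _} _ _) ()
  dyck-pair⇒matched (cat {_ ∷ _ ∷ _ ∷ _} _ _) ()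
  dyck-pair⇒matched (wrap _ {[]} _) refl = refl
  dyck-pair⇒matched (wrap _ {_ ∷ []} _) ()
  dyck-pair⇒matched (wrap _ {_ ∷ _ ∷ _} _) ()

  -- Upper bounds on dyck (α ∷ β ∷ []), one for each way of repairing the pair; the best is exact.
  data PairCost : Paren T → Paren T → ℕ → Set where
    matched     : ∀ a → PairCost (open′ a) (close′ a) 0
    opening-any : ∀ a β → PairCost (open′ a) β 1
    any-closing : ∀ α b → PairCost α (close′ b) 1
    any         : ∀ α β → PairCost α β 2

  pairCost-repair : PairCost α β e → ∃[ w ] Dyck w × Edit (α ∷ β ∷ []) w e
  pairCost-repair (matched a)       = _ , wrap a emp , edit-refl _
  pairCost-repair (opening-any a β) = _ , wrap a emp , match (subst nil)
  pairCost-repair (any-closing α b) = _ , wrap b emp , subst (match nil)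
  pairCost-repair (any α β)         = [] , emp , del (del nil)

  dyckDist-pair≤ : IsDyckDist (α ∷ β ∷ []) d → PairCost α β e → d ≤ e
  dyckDist-pair≤ (_ , optimal) c with w , dw , ed ← pairCost-repair c = optimal w _ dw ed

  close-open-¬edit₁ : Edit (close′ a ∷ open′ b ∷ []) w 1 → ¬ Dyck w
  close-open-¬edit₁ (match e) dw = dyck-head≢close dw refl
  close-open-¬edit₁ (subst {b = c} e) dw = dyck-last≢open {u = [ c ]} dw (cong (c ∷_) (edit-zero⇒≡ e))
  close-open-¬edit₁ (del e) dw = dyck-last≢open {u = []} dw (edit-zero⇒≡ e)
  close-open-¬edit₁ (ins {b = c} e) dw = dyck-last≢open {u = c ∷ close′ _ ∷ []} dw (cong (c ∷_) (edit-zero⇒≡ e))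

  dyckDist-pair-cost : IsDyckDist (α ∷ β ∷ []) d → ∃[ e ] PairCost α β e × e ≤ d
  dyckDist-pair-cost {open′ a} {close′ b} {zero} ((w , dw , ed) , _)
    with refl ← dyck-pair⇒matched dw (edit-zero⇒≡ ed) = 0 , matched a , z≤n
  dyckDist-pair-cost {open′ a} {β} {suc d} _ = 1 , opening-any a β , s≤s z≤n
  dyckDist-pair-cost {open′ a} {open′ b} {zero} ((w , dw , ed) , _)
    = ⊥-elim (dyck-last≢open {u = [ open′ a ]} dw (edit-zero⇒≡ ed))
  dyckDist-pair-cost {close′ a} {β} {zero} ((w , dw , ed) , _)
    = ⊥-elim (dyck-head≢close dw (edit-zero⇒≡ ed))
  dyckDist-pair-cost {close′ a} {close′ b} {suc d} _ = 1 , any-closing _ b , s≤s z≤n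
  dyckDist-pair-cost {close′ a} {open′ b} {1} ((w , dw , ed) , _) = ⊥-elim (close-open-¬edit₁ ed dw)
  dyckDist-pair-cost {close′ a} {open′ b} {suc (suc d)} _ = 2 , any _ _ , s≤s (s≤s z≤n)

  pairCost-enclose : PairCost α β e → Dyck w → Edit u w c → ∃[ w′ ] Dyck w′ × Edit (α ∷ u ++ [ β ]) w′ (c + e)
  pairCost-enclose (matched a)       dw ew = _ , wrap a dw , match (edit-++ ew (match nil))
  pairCost-enclose (opening-any a β) dw ew = _ , wrap a dw , match (edit-++ ew (subst nil))
  pairCost-enclose {c = c} (any-closing α b) dw ew =
    _ , wrap b dw , ≡.subst (Edit _ _) (trans (cong suc (+-identityʳ c)) (+-comm 1 c)) (subst (edit-++ ew (match nil)))
  pairCost-enclose {w = w} {c = c} (any α β) dw ew =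
    _ , ≡.subst Dyck (sym (++-identityʳ w)) dw ,
    ≡.subst (Edit _ _) (trans (cong suc (+-comm c 1)) (+-comm 2 c)) (del (edit-++ ew (del nil)))

  relabel⇒pairCost : Relabel α (open′ a) d → Relabel β (close′ a) e → ∃[ c ] PairCost α β c × c ≤ d + e
  relabel⇒pairCost {a = a} keep   keep   = 0 , matched a , z≤n
  relabel⇒pairCost {a = a} keep   change = 1 , opening-any a _ , ≤-refl
  relabel⇒pairCost {a = a} change keep   = 1 , any-closing _ a , ≤-refl
  relabel⇒pairCost         change change = 2 , any _ _ , ≤-refl

  pairCost-∙open≥1 : PairCost α (open′ a) e → 1 ≤ e
  pairCost-∙open≥1 (opening-any _ _) = s≤s z≤n
  pairCost-∙open≥1 (any _ _)         = s≤s z≤n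

  pairCost-close∙≥1 : PairCost (close′ a) β e → 1 ≤ e
  pairCost-close∙≥1 (any-closing _ _) = s≤s z≤n
  pairCost-close∙≥1 (any _ _)         = s≤s z≤n

  pairCost-∙open-relabel : PairCost α (open′ a) e → ∀ b → PairCost α (open′ b) e
  pairCost-∙open-relabel (opening-any a _) _ = opening-any a _
  pairCost-∙open-relabel (any _ _)         _ = any _ _

  pairCost-close∙-relabel : PairCost (close′ a) β e → ∀ b → PairCost (close′ b) β e
  pairCost-close∙-relabel (any-closing _ b) _ = any-closing _ b
  pairCost-close∙-relabel (any _ _)         _ = any _ _

  pairCost-∙open-∙open : PairCost α (open′ a) e → PairCost β (open′ b) e′ →
                         ∃[ c ] PairCost α β c × suc c ≤ e + e′
  pairCost-∙open-∙open (opening-any a _) p = 1 , opening-any a _ , s≤s (pairCost-∙open≥1 p)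
  pairCost-∙open-∙open (any _ _)         p = 2 , any _ _ , s≤s (s≤s (pairCost-∙open≥1 p))

  pairCost-close∙-close∙ : PairCost (close′ a) β e → PairCost (close′ b) α e′ →
                           ∃[ c ] PairCost α β c × suc c ≤ e + e′
  pairCost-close∙-close∙ (any-closing _ b) p = 1 , any-closing _ b , s≤s (pairCost-close∙≥1 p)
  pairCost-close∙-close∙ (any _ _)         p = 2 , any _ _ , s≤s (s≤s (pairCost-close∙≥1 p))

  pairCost-sign : PairCost α β e → sign β ℤ.- sign α ℤ.+ + 2 ℤ.≤ + (e + e)
  pairCost-sign (matched _)                    = ℤP.≤-refl
  pairCost-sign (opening-any _ (open′ _))      = ℤP.≤-refl
  pairCost-sign (opening-any _ (close′ _))     = ℤ.+≤+ z≤n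
  pairCost-sign (any-closing (open′ _) _)      = ℤ.+≤+ z≤n
  pairCost-sign (any-closing (close′ _) _)     = ℤP.≤-refl
  pairCost-sign (any (open′ _) (open′ _))      = ℤ.+≤+ (s≤s (s≤s z≤n))
  pairCost-sign (any (open′ _) (close′ _))     = ℤ.+≤+ z≤n
  pairCost-sign (any (close′ _) (open′ _))     = ℤP.≤-refl
  pairCost-sign (any (close′ _) (close′ _))    = ℤ.+≤+ (s≤s (s≤s z≤n))

  ∈-range⁺ : ∀ {a b k} → a ≤ k → k < b → k ∈ range {T} a b
  ∈-range⁺ {a} {b} a≤k k<b =
    ≡.subst (_∈ range {T} a b) (m+[n∸m]≡n a≤k) (∈-map⁺ (λ t → a + t) (∈-upTo⁺ (∸-monoˡ-< k<b a≤k)))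

  ∈-range⁻ : ∀ {a b k} → k ∈ range {T} a b → a ≤ k × k < b
  ∈-range⁻ {a} {b} k∈ with t , t∈ , refl ← ∈-map⁻ (λ t → a + t) k∈ = m≤m+n a t , (begin-strict
    a + t          <⟨ +-monoʳ-< a t<b∸a ⟩
    a + (b ∸ a)    ≡⟨ m+[n∸m]≡n {a} (<⇒≤ (m∸n≢0⇒n<m {b} {a} (λ b∸a≡0 → n≮0 (≡.subst (t <_) b∸a≡0 t<b∸a)))) ⟩
    b              ∎)
    where
      open ≤-Reasoning
      t<b∸a : t < b ∸ a
      t<b∸a = ∈-upTo⁻ t∈

  minOver-≤ : ∀ (f : ℕ → ℕ) {ks k} → k ∈ ks → minOver {T} (map f ks) ≤ f k
  minOver-≤ f {k₀ ∷ ks} k∈ = foldr-⊓-≤ (f k₀) (map f ks) (∈-map⁺ f k∈)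

  minOver-attained : ∀ (f : ℕ → ℕ) {ks k} → k ∈ ks → ∃[ k′ ] k′ ∈ ks × minOver {T} (map f ks) ≡ f k′
  minOver-attained f {k₀ ∷ ks} _ = ∈-map⁻ f (foldr-⊓-∈ (f k₀) (map f ks))

  height : Word → ℤ
  height u = sumℤ {T} (map sign u)

  height-++ : ∀ (u v : Word) → height (u ++ v) ≡ height u ℤ.+ height v
  height-++ []      v = sym (ℤP.+-identityˡ (height v))
  height-++ (c ∷ u) v = trans (cong (λ s → sign c ℤ.+ s) (height-++ u v)) (sym (ℤP.+-assoc (sign c) (height u) (height v)))

  one-step-excess : ∀ (α : Paren T) a → a ℤ.+ (a ℤ.+ sign α) ℤ.- (a ℤ.⊓ (a ℤ.+ sign α) ℤ.+ a ℤ.⊓ (a ℤ.+ sign α)) ≡ + 1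
  one-step-excess (open′ _) a rewrite ℤP.i≤j⇒i⊓j≡i (ℤP.i≤i+j a (+ 1)) = identity a
    where
      identity : ∀ a → a ℤ.+ (a ℤ.+ + 1) ℤ.- (a ℤ.+ a) ≡ + 1
      identity = ℤ-Solver.solve-∀
  one-step-excess (close′ _) a rewrite ℤP.i≥j⇒i⊓j≡j (ℤP.i-j≤i a (+ 1)) = identity a
    where
      identity : ∀ a → a ℤ.+ (a ℤ.+ -[1+ 0 ]) ℤ.- ((a ℤ.+ -[1+ 0 ]) ℤ.+ (a ℤ.+ -[1+ 0 ])) ≡ + 1
      identity = ℤ-Solver.solve-∀

  adjacent-heights : ∀ (α : Paren T) a → a ℤ.≤ a ℤ.+ sign α ℤ.+ + 1 × a ℤ.+ sign α ℤ.≤ a ℤ.+ + 1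
  adjacent-heights (open′ _) a = ℤP.≤-trans (ℤP.i≤i+j a (+ 1)) (ℤP.i≤i+j (a ℤ.+ + 1) (+ 1)) , ℤP.≤-refl
  adjacent-heights (close′ _) a = ℤP.≤-reflexive (identity a) , ℤP.+-monoʳ-≤ a ℤ.-≤+
    where
      identity : ∀ a → a ≡ a ℤ.+ -[1+ 0 ] ℤ.+ + 1
      identity = ℤ-Solver.solve-∀

  -- Positions are 0-based: x [ i ]= α says that the paper's x[i + 1] is α.
  _[_]=_ : Word → ℕ → Paren T → Set
  x [ i ]= α = sub x i (suc i) ≡ [ α ]

  module _ (x : Word) where

    sub-empty : ∀ i → sub x i i ≡ []
    sub-empty i rewrite n∸n≡0 i = refl

    sub-++ : ∀ {i k j} → i ≤ k → k ≤ j → sub x i j ≡ sub x i k ++ sub x k j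
    sub-++ {i} {k} {j} i≤k k≤j
      rewrite ∸-split i≤k k≤j | take-+ (k ∸ i) (j ∸ k) (drop i x) | drop-drop i (k ∸ i) x | m+[n∸m]≡n i≤k = refl

    length-sub : ∀ i {j} → j ≤ length x → length (sub x i j) ≡ j ∸ i
    length-sub i {j} j≤n rewrite length-take (j ∸ i) (drop i x) | length-drop i x = m≤n⇒m⊓n≡m (∸-monoˡ-≤ i j≤n)

    sub-≡-++ : ∀ {i j} u v → sub x i j ≡ u ++ v → i ≤ j → j ≤ length x →
               i + length u ≤ j × sub x i (i + length u) ≡ u × sub x (i + length u) j ≡ v
    sub-≡-++ {i} {j} u v eq i≤j j≤n =
      k≤j , ++-cancel-≡length _ _ u v (trans (sym (sub-++ (m≤m+n i (length u)) k≤j)) eq) length-prefix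
      where
        j∸i≡ : j ∸ i ≡ length u + length v
        j∸i≡ = trans (sym (length-sub i j≤n)) (trans (cong length eq) (length-++ u))
        k≤j : i + length u ≤ j
        k≤j = ≤-trans (+-monoʳ-≤ i (≤-trans (m≤m+n (length u) (length v)) (≤-reflexive (sym j∸i≡))))
                      (≤-reflexive (m+[n∸m]≡n i≤j))
        length-prefix : length (sub x i (i + length u)) ≡ length u
        length-prefix = trans (length-sub i (≤-trans k≤j j≤n)) (m+n∸m≡n i (length u))

    letter-exists : ∀ {i} → i < length x → ∃[ α ] x [ i ]= α
    letter-exists {i} i<n rewrite suc∸≡1 i = go x i i<n
      where
        go : ∀ (u : Word) i → i < length u → ∃[ α ] take 1 (drop i u) ≡ [ α ]
        go (c ∷ u) zero    _         = c , refl
        go (c ∷ u) (suc i) (s≤s i<n) = go u i i<n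

    letter-bound : ∀ {i} → x [ i ]= α → i < length x
    letter-bound {i = i} eq rewrite suc∸≡1 i = go x i eq
      where
        go : ∀ (u : Word) i → take 1 (drop i u) ≡ [ α ] → i < length u
        go []      zero    ()
        go []      (suc i) ()
        go (c ∷ u) zero    _  = s≤s z≤n
        go (c ∷ u) (suc i) eq = s≤s (go u i eq)

    h-sub : ∀ {i j} → i ≤ j → h x j ≡ h x i ℤ.+ height (sub x i j)
    h-sub {i} {j} i≤j = begin
      h x j                               ≡⟨ cong (λ m → height (take m x)) (m+[n∸m]≡n i≤j) ⟨
      height (take (i + (j ∸ i)) x)       ≡⟨ cong height (take-+ i (j ∸ i) x) ⟩
      height (take i x ++ sub x i j)      ≡⟨ height-++ (take i x) (sub x i j) ⟩
      h x i ℤ.+ height (sub x i j)        ∎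
      where open ≡-Reasoning

    h-suc : ∀ {i} → x [ i ]= α → h x (suc i) ≡ h x i ℤ.+ sign α
    h-suc {α = α} {i = i} eq = begin
      h x (suc i)                                   ≡⟨ h-sub (n≤1+n i) ⟩
      h x i ℤ.+ height (sub x i (suc i))            ≡⟨ cong (λ u → h x i ℤ.+ height u) eq ⟩
      h x i ℤ.+ (sign α ℤ.+ + 0)                    ≡⟨ cong (λ s → h x i ℤ.+ s) (ℤP.+-identityʳ (sign α)) ⟩
      h x i ℤ.+ sign α                              ∎
      where open ≡-Reasoning

    sub-nest : ∀ {i k} → suc i ≤ k → x [ i ]= α → x [ k ]= β → sub x i (suc k) ≡ α ∷ (sub x (suc i) k ++ [ β ])
    sub-nest {α = α} {β = β} {i} {k} i<k xα xβ = begin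
      sub x i (suc k)                               ≡⟨ sub-++ (n≤1+n i) (≤-trans i<k (n≤1+n k)) ⟩
      sub x i (suc i) ++ sub x (suc i) (suc k)      ≡⟨ cong₂ _++_ xα (sub-++ i<k (n≤1+n k)) ⟩
      α ∷ (sub x (suc i) k ++ sub x k (suc k))      ≡⟨ cong (λ u → α ∷ (sub x (suc i) k ++ u)) xβ ⟩
      α ∷ (sub x (suc i) k ++ [ β ])                ∎
      where open ≡-Reasoning

    hminAux≤ : ∀ i d t → t ≤ d → hminAux x i d ℤ.≤ h x (i + t)
    hminAux≤ i zero    zero _ rewrite +-identityʳ i = ℤP.≤-refl
    hminAux≤ i (suc d) t t≤ with m≤n⇒m<n∨m≡n t≤
    ... | inj₁ (s≤s t≤d) = ℤP.≤-trans (ℤP.i⊓j≤i (hminAux x i d) _) (hminAux≤ i d t t≤d)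
    ... | inj₂ refl      = ℤP.i⊓j≤j (hminAux x i d) _

    hminAux-glb : ∀ i d m → (∀ t → t ≤ d → m ℤ.≤ h x (i + t)) → m ℤ.≤ hminAux x i d
    hminAux-glb i zero    m bound = ≡.subst (m ℤ.≤_) (cong (h x) (+-identityʳ i)) (bound 0 z≤n)
    hminAux-glb i (suc d) m bound =
      ℤP.⊓-glb (hminAux-glb i d m (λ t t≤d → bound t (≤-trans t≤d (n≤1+n d)))) (bound (suc d) ≤-refl)

    hmin≤ : ∀ {i k j} → i ≤ k → k ≤ j → hmin x i j ℤ.≤ h x k
    hmin≤ {i} {k} {j} i≤k k≤j =
      ≡.subst (λ m → hmin x i j ℤ.≤ h x m) (m+[n∸m]≡n i≤k) (hminAux≤ i (j ∸ i) (k ∸ i) (∸-monoˡ-≤ i k≤j))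

    hmin-glb : ∀ {i j} m → i ≤ j → (∀ k → i ≤ k → k ≤ j → m ℤ.≤ h x k) → m ℤ.≤ hmin x i j
    hmin-glb {i} {j} m i≤j bound = hminAux-glb i (j ∸ i) m
      (λ t t≤ → bound (i + t) (m≤m+n i t) (≤-trans (+-monoʳ-≤ i t≤) (≤-reflexive (m+[n∸m]≡n i≤j))))

    sub-≡-∷ : ∀ {i j v} → sub x i j ≡ α ∷ v → i ≤ j → j ≤ length x → i < j × x [ i ]= α × sub x (suc i) j ≡ v
    sub-≡-∷ {α = α} {i} {j} {v} eq i≤j j≤n with sub-≡-++ [ α ] v eq i≤j j≤n
    ... | i+1≤j , xα , rest rewrite +-comm i 1 = i+1≤j , xα , rest

    -- Parses

    data Parse : ℕ → ℕ → ℕ → Set where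
      empty  : Parse i i 0
      delete : Parse i (suc i) 1
      _⊕_    : Parse i k c → Parse k j c′ → Parse i j (c + c′)
      nest   : x [ i ]= α → x [ k ]= β → PairCost α β e → Parse (suc i) k c → Parse i (suc k) (c + e)

    parse-≤ : Parse i j c → i ≤ j
    parse-≤ empty            = ≤-refl
    parse-≤ delete           = n≤1+n _
    parse-≤ (t ⊕ t′)         = ≤-trans (parse-≤ t) (parse-≤ t′)
    parse-≤ (nest _ _ _ t)   = ≤-trans (n≤1+n _) (≤-trans (parse-≤ t) (n≤1+n _))

    delete-all : i ≤ j → Parse i j (j ∸ i)
    delete-all {i} {j} i≤j = ≡.subst (λ m → Parse i m (j ∸ i)) (m+[n∸m]≡n i≤j) (go i (j ∸ i))
      where
        go : ∀ i d → Parse i (i + d) d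
        go i zero    = ≡.subst (λ m → Parse i m 0) (sym (+-identityʳ i)) empty
        go i (suc d) = ≡.subst (λ m → Parse i m (suc d)) (sym (+-suc i d)) (delete ⊕ go (suc i) d)

    delete-word : sub x i j ≡ u → i ≤ j → j ≤ length x → Parse i j (length u)
    delete-word {i} {j} eq i≤j j≤n =
      ≡.subst (Parse i j) (trans (sym (length-sub i j≤n)) (cong length eq)) (delete-all i≤j)

    parse⇒edit : Parse i j c → j ≤ length x → ∃[ w ] Dyck w × Edit (sub x i j) w c
    parse⇒edit {i} empty _ rewrite sub-empty i = [] , emp , nil
    parse⇒edit {i} delete j≤n with α , xα ← letter-exists j≤n rewrite xα = [] , emp , del nil
    parse⇒edit (t ⊕ t′) j≤n
      with w , dw , ew ← parse⇒edit t (≤-trans (parse-≤ t′) j≤n) | w′ , dw′ , ew′ ← parse⇒edit t′ j≤n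
      rewrite sub-++ (parse-≤ t) (parse-≤ t′) = w ++ w′ , cat dw dw′ , edit-++ ew ew′
    parse⇒edit (nest xα xβ p t) j≤n
      with w , dw , ew ← parse⇒edit t (≤-trans (n≤1+n _) j≤n)
      rewrite sub-nest (parse-≤ t) xα xβ = pairCost-enclose p dw ew

    record SurvivingLetter (i m : ℕ) (γ : Paren T) (k : ℕ) : Set where
      constructor surviving
      field
        {p} : ℕ
        {kept} : Paren T
        {relabelCost costBefore costAfter} : ℕ
        at-p : x [ p ]= kept
        relabel : Relabel kept γ relabelCost
        before : Parse i p costBefore
        after : Parse (suc p) m costAfter
        cost≤ : costBefore + costAfter + relabelCost ≤ k

    surviving-letter : sub x i m ≡ y → i ≤ m → m ≤ length x → EditToLetter y γ k → SurvivingLetter i m γ k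
    surviving-letter {i} eq i≤m m≤n (survivor pre {post} refl r le)
      with p≤m , σ-pre , σ-rest ← sub-≡-++ pre (_ ∷ post) eq i≤m m≤n
      with p<m , xα , σ-post ← sub-≡-∷ σ-rest p≤m m≤n =
      surviving xα r (delete-word σ-pre (m≤m+n i _) (≤-trans p≤m m≤n)) (delete-word σ-post p<m m≤n) le

    parse-enclose : ∀ {m₁ m₂ y₁ y₃ k₁ k₃} →
                    sub x i m₁ ≡ y₁ → i ≤ m₁ → Edit y₁ [ open′ a ] k₁ →
                    Parse m₁ m₂ c →
                    sub x m₂ j ≡ y₃ → m₂ ≤ j → j ≤ length x → Edit y₃ [ close′ a ] k₃ →
                    ∃[ c′ ] Parse i j c′ × c′ ≤ k₁ + (c + k₃)
    parse-enclose {c = c} {k₁ = k₁} {k₃} σ₁ i≤m₁ e₁ t σ₃ m₂≤j j≤n e₃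
      with m₁≤n ← ≤-trans (parse-≤ t) (≤-trans m₂≤j j≤n)
      with edit-to-letter e₁ | edit-to-letter e₃
    ... | inj₁ (refl , 1≤k₁) | _ =
      _ , delete-word σ₁ i≤m₁ m₁≤n ⊕ (t ⊕ delete-word σ₃ m₂≤j j≤n) ,
      +-mono-middle 0 c _ k₁ k₃ (≤-trans (edit-length e₃) (+-monoˡ-≤ k₃ 1≤k₁))
    ... | inj₂ _ | inj₁ (refl , 1≤k₃) =
      _ , delete-word σ₁ i≤m₁ m₁≤n ⊕ (t ⊕ delete-word σ₃ m₂≤j j≤n) ,
      +-mono-middle _ c 0 k₁ k₃ (≤-trans (≤-reflexive (+-identityʳ _))
        (≤-trans (edit-length e₁) (≤-trans (≤-reflexive (+-comm 1 k₁)) (+-monoʳ-≤ k₁ 1≤k₃))))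
    ... | inj₂ l₁ | inj₂ l₃
      with surviving {relabelCost = d₁} {a₁} {a₂} xα r₁ before₁ after₁ le₁ ← surviving-letter σ₁ i≤m₁ m₁≤n l₁
         | surviving {relabelCost = d₃} {b₁} {b₂} xβ r₃ before₃ after₃ le₃ ← surviving-letter σ₃ m₂≤j j≤n l₃
      with e , p , e≤ ← relabel⇒pairCost r₁ r₃ =
      _ , before₁ ⊕ (nest xα xβ p (after₁ ⊕ (t ⊕ before₃)) ⊕ after₃) ,
      enclose-cost a₁ a₂ c b₁ b₂ e d₁ d₃ k₁ k₃ e≤ le₁ le₃

    edit⇒parse : Dyck w → Edit y w k → sub x i j ≡ y → i ≤ j → j ≤ length x → ∃[ c ] Parse i j c × c ≤ k
    edit⇒parse emp e σ i≤j j≤n = _ , delete-word σ i≤j j≤n , edit-length e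
    edit⇒parse (cat {u} du dv) e σ i≤j j≤n
      with editSplit refl e₁ e₂ refl ← edit-split u e
      with m≤j , σ₁ , σ₂ ← sub-≡-++ _ _ σ i≤j j≤n
      with c₁ , t₁ , l₁ ← edit⇒parse du e₁ σ₁ (m≤m+n _ _) (≤-trans m≤j j≤n)
         | c₂ , t₂ , l₂ ← edit⇒parse dv e₂ σ₂ m≤j j≤n
      = _ , t₁ ⊕ t₂ , +-mono-≤ l₁ l₂
    edit⇒parse (wrap a {u} du) e σ i≤j j≤n
      with editSplit {k₁ = k₁} refl e₁ e-rest refl ← edit-split [ open′ a ] e
      with editSplit {k₂ = k₃} refl e₂ e₃ refl ← edit-split u e-rest
      with m₁≤j , σ₁ , σ-rest ← sub-≡-++ _ _ σ i≤j j≤n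
      with m₂≤j , σ₂ , σ₃ ← sub-≡-++ _ _ σ-rest m₁≤j j≤n
      with c , t , l ← edit⇒parse du e₂ σ₂ (m≤m+n _ _) (≤-trans m₂≤j j≤n)
      with c′ , t′ , l′ ← parse-enclose σ₁ (m≤m+n _ _) e₁ t σ₃ m₂≤j j≤n e₃
      = c′ , t′ , ≤-trans l′ (+-monoʳ-≤ k₁ (+-monoˡ-≤ k₃ l))

    -- Normal form of parses

    Cheaper : ℕ → ℕ → ℕ → Set
    Cheaper i j c = ∃[ c′ ] Parse i j c′ × suc c′ ≤ c

    record FirstPaired (i j c : ℕ) : Set where
      constructor firstPaired
      field
        {q c₁ c₂ cost} : ℕ
        {first partner} : Paren T
        at-i : x [ i ]= first
        at-q : x [ q ]= partner
        pairCost : PairCost first partner cost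
        inside : Parse (suc i) q c₁
        rest : Parse (suc q) j c₂
        cost≤ : c₁ + cost + c₂ ≤ c

    first-letter : Parse i j c → i < j → Cheaper (suc i) j c ⊎ FirstPaired i j c
    first-letter empty i<i = ⊥-elim (<-irrefl refl i<i)
    first-letter delete _ = inj₁ (0 , empty , ≤-refl)
    first-letter (_⊕_ {c = a} {c′ = b} t₁ t₂) i<j with m≤n⇒m<n∨m≡n (parse-≤ t₁)
    ... | inj₁ i<k with first-letter t₁ i<k
    ...   | inj₁ (c′ , t , le) = inj₁ (c′ + b , t ⊕ t₂ , +-monoˡ-≤ b le)
    ...   | inj₂ (firstPaired {c₁ = c₁} {c₂} {e} xα xβ p tin trest le) =
            inj₂ (firstPaired xα xβ p tin (trest ⊕ t₂) (≤-trans (≤-reflexive (sym (+-assoc (c₁ + e) c₂ b))) (+-monoˡ-≤ b le)))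
    first-letter (_⊕_ {c = a} {c′ = b} t₁ t₂) i<j | inj₂ refl with first-letter t₂ i<j
    ...   | inj₁ (c′ , t , le) = inj₁ (c′ , t , ≤-trans le (m≤n+m b a))
    ...   | inj₂ (firstPaired xα xβ p tin trest le) = inj₂ (firstPaired xα xβ p tin trest (≤-trans le (m≤n+m b a)))
    first-letter (nest {e = e} {c = a} xα xβ p t) _ = inj₂ (firstPaired xα xβ p t empty (≤-reflexive (+-identityʳ (a + e))))

    record LastPaired (i j c : ℕ) : Set where
      constructor lastPaired
      field
        {p c₁ c₂ cost} : ℕ
        {partner last} : Paren T
        at-p : x [ p ]= partner
        at-j : x [ j ]= last
        pairCost : PairCost partner last cost
        rest : Parse i p c₁
        inside : Parse (suc p) j c₂
        cost≤ : c₁ + c₂ + cost ≤ c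

    last-letter : Parse i (suc j) c → i ≤ j → Cheaper i j c ⊎ LastPaired i j c
    last-letter empty i≤j = ⊥-elim (<-irrefl refl i≤j)
    last-letter delete _ = inj₁ (0 , empty , ≤-refl)
    last-letter (_⊕_ {c = a} {c′ = b} t₁ t₂) i≤j with m≤n⇒m<n∨m≡n (parse-≤ t₂)
    ... | inj₁ (s≤s k≤j) with last-letter t₂ k≤j
    ...   | inj₁ (c′ , t , le) = inj₁ (a + c′ , t₁ ⊕ t , ≤-trans (≤-reflexive (sym (+-suc a c′))) (+-monoʳ-≤ a le))
    ...   | inj₂ (lastPaired {c₁ = c₁} {c₂} {e} xα xβ p trest tin le) =
            inj₂ (lastPaired xα xβ p (t₁ ⊕ trest) tin (≤-trans (≤-reflexive (reassoc a c₁ c₂ e)) (+-monoʳ-≤ a le)))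
      where
        reassoc : ∀ a c₁ c₂ e → a + c₁ + c₂ + e ≡ a + (c₁ + c₂ + e)
        reassoc = solve-∀
    last-letter (_⊕_ {c = a} {c′ = b} t₁ t₂) i≤j | inj₂ refl with last-letter t₁ i≤j
    ...   | inj₁ (c′ , t , le) = inj₁ (c′ , t , ≤-trans le (m≤m+n a b))
    ...   | inj₂ (lastPaired xα xβ p trest tin le) = inj₂ (lastPaired xα xβ p trest tin (≤-trans le (m≤m+n a b)))
    last-letter (nest xα xβ p t) _ = inj₂ (lastPaired xα xβ p empty t ≤-refl)

    parse-letter-cost : Parse i (suc i) c → 1 ≤ c
    parse-letter-cost t with first-letter t ≤-refl
    ... | inj₁ (_ , _ , cheaper) = ≤-trans (s≤s z≤n) cheaper
    ... | inj₂ (firstPaired _ _ _ tin trest _) = ⊥-elim (<-irrefl refl (≤-trans (s≤s (parse-≤ tin)) (parse-≤ trest)))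

    letter-unique : ∀ i → x [ i ]= α → x [ i ]= β → α ≡ β
    letter-unique _ xα xβ = ∷-injectiveˡ (trans (sym xα) xβ)

    shorten-trailing-opens : Parse i (suc (suc m)) c → i ≤ m → x [ m ]= open′ a → x [ suc m ]= open′ b →
                             Cheaper i (suc m) c ⊎ Cheaper i m c
    shorten-trailing-opens {m = m} {a = a} t i≤m x[m] x[m+1] with last-letter t (≤-trans i≤m (n≤1+n _))
    ... | inj₁ cheaper = inj₁ cheaper
    ... | inj₂ (lastPaired {c₁ = c₁} {c₂} {e} xα xβ p trest tin le)
      with refl ← letter-unique (suc m) xβ x[m+1]
      with m≤n⇒m<n∨m≡n (≤-pred (parse-≤ tin))
    ...   | inj₂ refl = inj₂ (c₁ , trest , ≤-trans (≤-reflexive (+-comm 1 c₁))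
                              (≤-trans (+-monoʳ-≤ c₁ (pairCost-∙open≥1 p)) (≤-trans (+-monoˡ-≤ e (m≤m+n c₁ c₂)) le)))
    ...   | inj₁ p<m with last-letter tin p<m
    ...     | inj₁ (c₃ , tin′ , le₃) =
              inj₁ (c₁ + (c₃ + e) , trest ⊕ nest xα x[m] (pairCost-∙open-relabel p a) tin′ ,
                    ≤-trans (≤-reflexive (sym (+-suc c₁ (c₃ + e))))
                      (≤-trans (+-monoʳ-≤ c₁ (+-monoˡ-≤ e le₃)) (≤-trans (≤-reflexive (sym (+-assoc c₁ c₂ e))) le)))
    ...     | inj₂ (lastPaired {c₁ = d₁} {d₂} {e′} xα′ xβ′ p′ trest′ tin′ le′)
      with refl ← letter-unique m xβ′ x[m]
      with e₃ , p₃ , e₃< ← pairCost-∙open-∙open p p′ =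
      inj₂ (c₁ + ((d₁ + e₃) + d₂) , trest ⊕ (nest xα xα′ p₃ trest′ ⊕ tin′) ,
            exchange-cost-trailing c₁ c₂ d₁ d₂ e e′ e₃ _ le le′ e₃<)

    shorten-leading-closes : Parse k j c → suc (suc k) ≤ j → x [ k ]= close′ a → x [ suc k ]= close′ b →
                             Cheaper (suc k) j c ⊎ Cheaper (suc (suc k)) j c
    shorten-leading-closes {k = k} {b = b} t k+2≤j x[k] x[k+1] with first-letter t (≤-trans (n≤1+n _) k+2≤j)
    ... | inj₁ cheaper = inj₁ cheaper
    ... | inj₂ (firstPaired {c₁ = c₁} {c₂} {e} xα xβ p tin trest le)
      with refl ← letter-unique k xα x[k]
      with m≤n⇒m<n∨m≡n (parse-≤ tin)
    ...   | inj₂ refl = inj₂ (c₂ , trest , ≤-trans (+-monoˡ-≤ c₂ (≤-trans (pairCost-close∙≥1 p) (m≤n+m e c₁))) le)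
    ...   | inj₁ k+1<q with first-letter tin k+1<q
    ...     | inj₁ (c₃ , tin′ , le₃) =
              inj₁ ((c₃ + e) + c₂ , nest x[k+1] xβ (pairCost-close∙-relabel p b) tin′ ⊕ trest ,
                    ≤-trans (+-monoˡ-≤ c₂ (+-monoˡ-≤ e le₃)) le)
    ...     | inj₂ (firstPaired {c₁ = d₁} {d₂} {e′} xα′ xβ′ p′ tin′ trest′ le′)
      with refl ← letter-unique (suc k) xα′ x[k+1]
      with e₃ , p₃ , e₃< ← pairCost-close∙-close∙ p p′ =
      inj₂ (d₁ + ((d₂ + e₃) + c₂) , tin′ ⊕ (nest xβ′ xβ p₃ trest′ ⊕ trest) ,
            exchange-cost-leading c₁ c₂ d₁ d₂ e e′ e₃ _ le le′ e₃<)

    data LetterView (i : ℕ) : Set where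
      opening : x [ i ]= open′ a  → LetterView i
      closing : x [ i ]= close′ a → LetterView i

    view-letter : i < length x → LetterView i
    view-letter i<n with letter-exists i<n
    ... | open′ _  , xα = opening xα
    ... | close′ _ , xα = closing xα

    valley : x [ i ]= close′ a → x [ suc i ]= open′ b → Bool.T (isValley x (suc i))
    valley {i} x[i] x[i+1] =
      ∧-intro {⌊ suc i <? length x ⌋} (fromWitness (letter-bound x[i+1]))
        (∧-intro {⌊ h x (suc i) ℤ.<? h x i ⌋} (fromWitness descent) (fromWitness ascent))
      where
        descent : h x (suc i) ℤ.< h x i
        descent = ≡.subst₂ ℤ._<_ (sym (h-suc x[i])) (ℤP.+-identityʳ (h x i)) (ℤP.+-monoʳ-< (h x i) ℤ.-<+)
        ascent : h x (suc i) ℤ.< h x (suc (suc i))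
        ascent = ≡.subst₂ ℤ._<_ (ℤP.+-identityʳ (h x (suc i))) (sym (h-suc x[i+1])) (ℤP.+-monoʳ-< (h x (suc i)) (ℤ.+<+ (s≤s z≤n)))

    -- Boolean predicates of Defs wrapped in records, so that their indices can be inferred.
    record InK (p : ℕ) : Set where
      constructor inK✓
      field holds : Bool.T (inK x p)

    inK-before-valley : x [ i ]= close′ a → x [ suc i ]= open′ b → InK i
    inK-before-valley {zero} x[i] x[i+1] = inK✓ $
      ∧-intro {⌊ 0 ≤? length x ⌋} _ (∨-introʳ Bool.false (∨-introʳ Bool.false (valley x[i] x[i+1])))
    inK-before-valley {suc u} x[i] x[i+1] = inK✓ $
      ∧-intro {⌊ suc u ≤? length x ⌋} (fromWitness (<⇒≤ (letter-bound x[i])))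
        (∨-introʳ (isValley x u) (∨-introʳ (isValley x (suc u)) (valley x[i] x[i+1])))

    inK-valley : x [ i ]= close′ a → x [ suc i ]= open′ b → InK (suc i)
    inK-valley {i} x[i] x[i+1] = inK✓ $
      ∧-intro {⌊ suc i ≤? length x ⌋} (fromWitness (<⇒≤ (letter-bound x[i+1])))
        (∨-introʳ (isValley x i) (∨-introˡ (isValley x (suc i)) (isValley x (suc (suc i))) (valley x[i] x[i+1])))

    inK-after-valley : x [ i ]= close′ a → x [ suc i ]= open′ b → InK (suc (suc i))
    inK-after-valley {i} x[i] x[i+1] = inK✓ $
      ∧-intro {⌊ suc (suc i) ≤? length x ⌋} (fromWitness (letter-bound x[i+1]))
        (∨-introˡ (isValley x (suc i)) (isValley x (suc (suc i)) ∨ isValley x (suc (suc (suc i)))) (valley x[i] x[i+1]))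

    -- Literally the predicate filtered by `splits`.
    allowed : ℕ → ℕ → ℕ → Bool
    allowed i j k = inK x k ∨ eqb {T} k (suc i) ∨ eqb {T} k (suc (suc i)) ∨ eqb {T} k (j ∸ 2) ∨ eqb {T} k (j ∸ 1)

    record Allowed (i j k : ℕ) : Set where
      constructor allowed✓
      field holds : Bool.T (allowed i j k)

    allowed? : ∀ i j k → Dec (Allowed i j k)
    allowed? i j k = map′ allowed✓ Allowed.holds (T? (allowed i j k))

    allowed-intro : InK k ⊎ k ≡ suc i ⊎ k ≡ suc (suc i) ⊎ k ≡ j ∸ 2 ⊎ k ≡ j ∸ 1 → Allowed i j k
    allowed-intro {k} {i} {j} = allowed✓ ∘ choose
      where
        b₀ = inK x k
        b₁ = eqb {T} k (suc i)
        b₂ = eqb {T} k (suc (suc i))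
        b₃ = eqb {T} k (j ∸ 2)
        b₄ = eqb {T} k (j ∸ 1)
        choose : InK k ⊎ k ≡ suc i ⊎ k ≡ suc (suc i) ⊎ k ≡ j ∸ 2 ⊎ k ≡ j ∸ 1 → Bool.T (b₀ ∨ b₁ ∨ b₂ ∨ b₃ ∨ b₄)
        choose (inj₁ (inK✓ t)) = ∨-introˡ b₀ (b₁ ∨ b₂ ∨ b₃ ∨ b₄) t
        choose (inj₂ (inj₁ e)) = ∨-introʳ b₀ (∨-introˡ b₁ (b₂ ∨ b₃ ∨ b₄) (fromWitness e))
        choose (inj₂ (inj₂ (inj₁ e))) = ∨-introʳ b₀ (∨-introʳ b₁ (∨-introˡ b₂ (b₃ ∨ b₄) (fromWitness e)))
        choose (inj₂ (inj₂ (inj₂ (inj₁ e)))) = ∨-introʳ b₀ (∨-introʳ b₁ (∨-introʳ b₂ (∨-introˡ b₃ b₄ (fromWitness e))))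
        choose (inj₂ (inj₂ (inj₂ (inj₂ e)))) = ∨-introʳ b₀ (∨-introʳ b₁ (∨-introʳ b₂ (∨-introʳ b₃ (fromWitness e))))

    allowed-first : Allowed i j (suc i)
    allowed-first = allowed-intro (inj₂ (inj₁ refl))

    allowed-last : Allowed i j (j ∸ 1)
    allowed-last = allowed-intro (inj₂ (inj₂ (inj₂ (inj₂ refl))))

    ¬allowed⇒¬K : ¬ Allowed i j k → ¬ InK k
    ¬allowed⇒¬K ¬ok = ¬ok ∘ allowed-intro ∘ inj₁

    ¬allowed⇒far-from-i : ¬ Allowed i j k → i < k → suc (suc (suc i)) ≤ k
    ¬allowed⇒far-from-i ¬ok i<k =
      3+i≤k-unless-near i<k (¬ok ∘ allowed-intro ∘ inj₂ ∘ inj₁) (¬ok ∘ allowed-intro ∘ inj₂ ∘ inj₂ ∘ inj₁)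

    ¬allowed⇒far-from-j : ¬ Allowed i j k → k < j → suc (suc (suc k)) ≤ j
    ¬allowed⇒far-from-j ¬ok k<j =
      3+k≤j-unless-near k<j (¬ok ∘ allowed-intro ∘ inj₂ ∘ inj₂ ∘ inj₂ ∘ inj₂)
                            (¬ok ∘ allowed-intro ∘ inj₂ ∘ inj₂ ∘ inj₂ ∘ inj₁)

    ∈-splits⁺ : Allowed i j k → i < k → k < j → k ∈ splits x i j
    ∈-splits⁺ {i} {j} ok i<k k<j = ∈-filter⁺ (λ k → T? (allowed i j k)) (∈-range⁺ i<k k<j) (Allowed.holds ok)

    ∈-splits⁻ : k ∈ splits x i j → i < k × k < j
    ∈-splits⁻ {i = i} {j} k∈ = ∈-range⁻ (proj₁ (∈-filter⁻ (λ k → T? (allowed i j k)) {xs = range {T} (suc i) j} k∈))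

    data AllowedRoot (i : ℕ) : ℕ → ℕ → Set where
      split : Allowed i j k → i < k → k < j → Parse i k c′ → Parse k j c″ → c′ + c″ ≤ c → AllowedRoot i j c
      nest  : x [ i ]= α → x [ j ]= β → PairCost α β e → Parse (suc i) j c′ → c′ + e ≤ c → AllowedRoot i (suc j) c

    -- A split point that is not allowed lies inside a run of opening (resp. closing) brackets
    -- and can slide along it: each step shortens a parse of the adjacent part by at least one,
    -- which pays for deleting or pairing the letters it passes.
    slide-left : ∀ bound → k ≤ bound → i < k → k < j → j ≤ length x → x [ k ]= open′ a →
                 Parse i k c′ → Parse k j c″ → c′ + c″ ≤ c → AllowedRoot i j c
    slide-left-past-opens : ∀ bound → suc (suc m) ≤ suc bound → i < m → suc (suc m) < j → j ≤ length x →
                            x [ m ]= open′ a → x [ suc m ]= open′ b →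
                            Parse i (suc (suc m)) c′ → Parse (suc (suc m)) j c″ → c′ + c″ ≤ c → AllowedRoot i j c

    slide-left zero k≤0 i<k = ⊥-elim (n≮0 (≤-trans i<k k≤0))
    slide-left {k = k} {i = i} {j = j} (suc bound) k≤ i<k k<j j≤n x[k] t₁ t₂ le with allowed? i j k
    ... | yes ok = split ok i<k k<j t₁ t₂ le
    ... | no ¬ok with ¬allowed⇒far-from-i ¬ok i<k
    ...   | s≤s (s≤s i<m) with view-letter (≤-trans (n≤1+n _) (≤-trans k<j j≤n))
    ...     | closing x[m+1] = ⊥-elim (¬allowed⇒¬K ¬ok (inK-valley x[m+1] x[k]))
    ...     | opening x[m+1] with view-letter (≤-trans (n≤1+n _) (≤-trans (n≤1+n _) (≤-trans k<j j≤n)))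
    ...       | closing x[m] = ⊥-elim (¬allowed⇒¬K ¬ok (inK-after-valley x[m] x[m+1]))
    ...       | opening x[m] = slide-left-past-opens bound k≤ i<m k<j j≤n x[m] x[m+1] t₁ t₂ le

    slide-left-past-opens bound k≤ i<m k<j j≤n x[m] x[m+1] t₁ t₂ le with shorten-trailing-opens t₁ (<⇒≤ i<m) x[m] x[m+1]
    ... | inj₁ (_ , t , cheaper) =
          slide-left bound (≤-pred k≤) (≤-trans i<m (n≤1+n _)) (≤-trans (n≤1+n _) k<j) j≤n x[m+1]
                     t (delete ⊕ t₂) (pay-one-left cheaper le)
    ... | inj₂ (_ , t , cheaper) =
          slide-left bound (≤-trans (n≤1+n _) (≤-pred k≤)) i<m (≤-trans (n≤1+n _) (≤-trans (n≤1+n _) k<j)) j≤n x[m]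
                     t (nest x[m] x[m+1] (opening-any _ _) empty ⊕ t₂) (pay-one-left cheaper le)

    slide-right : ∀ bound → j ∸ suc k ≤ bound → i < suc k → suc k < j → j ≤ length x → x [ k ]= close′ a →
                  Parse i (suc k) c′ → Parse (suc k) j c″ → c′ + c″ ≤ c → AllowedRoot i j c
    slide-right {j = j} {k = k} zero j∸k≤0 _ k<j = ⊥-elim (n≮0 (≤-trans (m<n⇒0<n∸m k<j) j∸k≤0))
    slide-right {j = j} {k = k} {i = i} (suc bound) j∸k≤ i<k k<j j≤n x[k] t₁ t₂ le with allowed? i j (suc k)
    ... | yes ok = split ok i<k k<j t₁ t₂ le
    ... | no ¬ok with k+4≤j ← ¬allowed⇒far-from-j ¬ok k<j
                 with view-letter (≤-trans (m≤n+m (suc (suc k)) 2) (≤-trans k+4≤j j≤n))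
    ...   | opening x[k+1] = ⊥-elim (¬allowed⇒¬K ¬ok (inK-valley x[k] x[k+1]))
    ...   | closing x[k+1] with view-letter (≤-trans (n≤1+n (suc (suc (suc k)))) (≤-trans k+4≤j j≤n))
    ...     | opening x[k+2] = ⊥-elim (¬allowed⇒¬K ¬ok (inK-before-valley x[k+1] x[k+2]))
    ...     | closing x[k+2] with shorten-leading-closes t₂ (≤-trans (n≤1+n _) k+4≤j) x[k+1] x[k+2]
    ...       | inj₁ (_ , t , cheaper) =
                slide-right bound (∸-suc≤ j (suc k) j∸k≤) (≤-trans i<k (n≤1+n _)) (≤-trans (n≤1+n _) k+4≤j) j≤n x[k+1]
                            (t₁ ⊕ delete) t (pay-one-right cheaper le)
    ...       | inj₂ (_ , t , cheaper) =
                slide-right bound (≤-trans (∸-monoʳ-≤ j (n≤1+n _)) (∸-suc≤ j (suc k) j∸k≤))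
                            (≤-trans i<k (≤-trans (n≤1+n _) (n≤1+n _)))
                            k+4≤j j≤n x[k+2]
                            (t₁ ⊕ nest x[k+1] x[k+2] (any-closing _ _) empty) t (pay-one-right cheaper le)

    root-at : ∀ k → suc i < k → k < j → j ≤ length x → Parse i k c′ → Parse k j c″ → c′ + c″ ≤ c → AllowedRoot i j c
    root-at {i} {j} k i+1<k k<j j≤n t₁ t₂ le with allowed? i j k
    ... | yes ok = split ok (<⇒≤ i+1<k) k<j t₁ t₂ le
    ... | no ¬ok with ¬allowed⇒far-from-i ¬ok (<⇒≤ i+1<k)
    ...   | s≤s (s≤s i<m) with view-letter (≤-trans (<⇒≤ k<j) j≤n)
    ...     | closing x[m+1] = slide-right (j ∸ k) ≤-refl (<⇒≤ i+1<k) k<j j≤n x[m+1] t₁ t₂ le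
    ...     | opening x[m+1] with view-letter (≤-trans (n≤1+n _) (≤-trans (<⇒≤ k<j) j≤n))
    ...       | closing x[m] = ⊥-elim (¬allowed⇒¬K ¬ok (inK-after-valley x[m] x[m+1]))
    ...       | opening x[m] = slide-left-past-opens _ ≤-refl i<m k<j j≤n x[m] x[m+1] t₁ t₂ le

    allowed-root : Parse i j c → suc i < j → j ≤ length x → AllowedRoot i j c
    allowed-root t i+1<j j≤n with first-letter t (<⇒≤ i+1<j)
    ... | inj₁ (_ , t′ , cheaper) = split allowed-first ≤-refl i+1<j delete t′ cheaper
    ... | inj₂ (firstPaired {c₁ = c₁} {cost = e} xα xβ p tin trest le) with m≤n⇒m<n∨m≡n (parse-≤ trest)
    ...   | inj₂ refl   = nest xα xβ p tin (≤-trans (m≤m+n (c₁ + e) _) le)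
    ...   | inj₁ q+1<j = root-at _ (s≤s (parse-≤ tin)) q+1<j j≤n (nest xα xβ p tin) trest le

  -- Excess height

  module _ (x : Word) where

    excess : ℕ → ℕ → ℤ
    excess i j = h x i ℤ.+ h x j ℤ.- (hmin x i j ℤ.+ hmin x i j)

    excess-empty : ∀ i → excess i i ≡ + 0
    excess-empty i rewrite n∸n≡0 i = ℤP.+-inverseʳ (h x i ℤ.+ h x i)

    excess-superadditive : i ≤ k → k ≤ j → excess i j ℤ.≤ excess i k ℤ.+ excess k j
    excess-superadditive {i} {k} {j} i≤k k≤j = ≤-by-difference (δ ℤ.+ δ) (identity (h x i) (h x k) (h x j) μ₁ μ₂ μ) (0≤-double 0≤δ)
      where
        μ₁ = hmin x i k
        μ₂ = hmin x k j
        μ = hmin x i j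
        δ = μ ℤ.+ h x k ℤ.- (μ₁ ℤ.+ μ₂)
        μ₁⊓μ₂≤μ : μ₁ ℤ.⊓ μ₂ ℤ.≤ μ
        μ₁⊓μ₂≤μ = hmin-glb x (μ₁ ℤ.⊓ μ₂) (≤-trans i≤k k≤j) λ l i≤l l≤j → case ≤-total l k of λ where
          (inj₁ l≤k) → ℤP.≤-trans (ℤP.i⊓j≤i μ₁ μ₂) (hmin≤ x i≤l l≤k)
          (inj₂ k≤l) → ℤP.≤-trans (ℤP.i⊓j≤j μ₁ μ₂) (hmin≤ x k≤l l≤j)
        0≤δ : + 0 ℤ.≤ δ
        0≤δ = ℤP.i≤j⇒0≤j-i (ℤP.≤-trans (+-≤-⊓-+ (hmin≤ x i≤k ≤-refl) (hmin≤ x ≤-refl k≤j)) (ℤP.+-monoˡ-≤ (h x k) μ₁⊓μ₂≤μ))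
        identity : ∀ hi hk hj a b μ →
          (hi ℤ.+ hk ℤ.- (a ℤ.+ a)) ℤ.+ (hk ℤ.+ hj ℤ.- (b ℤ.+ b)) ℤ.- (hi ℤ.+ hj ℤ.- (μ ℤ.+ μ))
          ≡ (μ ℤ.+ hk ℤ.- (a ℤ.+ b)) ℤ.+ (μ ℤ.+ hk ℤ.- (a ℤ.+ b))
        identity = ℤ-Solver.solve-∀

    hmin-letter : ∀ i → hmin x i (suc i) ≡ h x i ℤ.⊓ h x (suc i)
    hmin-letter i rewrite suc∸≡1 i | +-comm i 1 = refl

    excess-letter : x [ i ]= α → excess i (suc i) ≡ + 1
    excess-letter {i} {α} xα = begin
      excess i (suc i)
        ≡⟨ cong (λ μ → hᵢ ℤ.+ h x (suc i) ℤ.- (μ ℤ.+ μ)) (hmin-letter i) ⟩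
      hᵢ ℤ.+ h x (suc i) ℤ.- (hᵢ ℤ.⊓ h x (suc i) ℤ.+ hᵢ ℤ.⊓ h x (suc i))
        ≡⟨ cong (λ h′ → hᵢ ℤ.+ h′ ℤ.- (hᵢ ℤ.⊓ h′ ℤ.+ hᵢ ℤ.⊓ h′)) (h-suc x xα) ⟩
      hᵢ ℤ.+ (hᵢ ℤ.+ sign α) ℤ.- (hᵢ ℤ.⊓ (hᵢ ℤ.+ sign α) ℤ.+ hᵢ ℤ.⊓ (hᵢ ℤ.+ sign α))
        ≡⟨ one-step-excess α hᵢ ⟩
      + 1 ∎
      where
        open ≡-Reasoning
        hᵢ = h x i

    module _ {i j} (xα : x [ i ]= α) (xβ : x [ j ]= β) where
      private
        μ  = hmin x i (suc j)
        μ′ = hmin x (suc i) j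

      excess-nest : excess i (suc j) ≡ excess (suc i) j ℤ.+ (sign β ℤ.- sign α) ℤ.+ ((μ′ ℤ.- μ) ℤ.+ (μ′ ℤ.- μ))
      excess-nest = begin
        h x i ℤ.+ h x (suc j) ℤ.- (μ ℤ.+ μ)
          ≡⟨ cong (λ h′ → h x i ℤ.+ h′ ℤ.- (μ ℤ.+ μ)) (h-suc x xβ) ⟩
        h x i ℤ.+ (h x j ℤ.+ sign β) ℤ.- (μ ℤ.+ μ)
          ≡⟨ identity (h x i) (h x j) (sign α) (sign β) μ μ′ ⟩
        h x i ℤ.+ sign α ℤ.+ h x j ℤ.- (μ′ ℤ.+ μ′) ℤ.+ (sign β ℤ.- sign α) ℤ.+ ((μ′ ℤ.- μ) ℤ.+ (μ′ ℤ.- μ))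
          ≡⟨ cong (λ h′ → h′ ℤ.+ h x j ℤ.- (μ′ ℤ.+ μ′) ℤ.+ (sign β ℤ.- sign α) ℤ.+ ((μ′ ℤ.- μ) ℤ.+ (μ′ ℤ.- μ))) (h-suc x xα) ⟨
        excess (suc i) j ℤ.+ (sign β ℤ.- sign α) ℤ.+ ((μ′ ℤ.- μ) ℤ.+ (μ′ ℤ.- μ)) ∎
        where
          open ≡-Reasoning
          identity : ∀ a b s t m m′ → a ℤ.+ (b ℤ.+ t) ℤ.- (m ℤ.+ m)
                     ≡ a ℤ.+ s ℤ.+ b ℤ.- (m′ ℤ.+ m′) ℤ.+ (t ℤ.- s) ℤ.+ ((m′ ℤ.- m) ℤ.+ (m′ ℤ.- m))
          identity = ℤ-Solver.solve-∀

      hmin-inner-1≤ : suc i ≤ j → μ′ ℤ.- + 1 ℤ.≤ μ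
      hmin-inner-1≤ i<j = hmin-glb x (μ′ ℤ.- + 1) (≤-trans (n≤1+n i) (≤-trans i<j (n≤1+n j))) λ l i≤l l≤j+1 →
        ≤+1⇒-1≤ (μ′≤h+1 l i≤l l≤j+1)
        where
          μ′≤h+1 : ∀ l → i ≤ l → l ≤ suc j → μ′ ℤ.≤ h x l ℤ.+ + 1
          μ′≤h+1 l i≤l l≤j+1 with m≤n⇒m<n∨m≡n i≤l
          ... | inj₂ refl = ℤP.≤-trans (hmin≤ x ≤-refl i<j)
                              (≡.subst (ℤ._≤ h x i ℤ.+ + 1) (sym (h-suc x xα)) (proj₂ (adjacent-heights α (h x i))))
          ... | inj₁ i<l with m≤n⇒m<n∨m≡n l≤j+1
          ...   | inj₂ refl = ℤP.≤-trans (hmin≤ x i<j ≤-refl)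
                                (≡.subst (λ h′ → h x j ℤ.≤ h′ ℤ.+ + 1) (sym (h-suc x xβ)) (proj₁ (adjacent-heights β (h x j))))
          ...   | inj₁ (s≤s l≤j) = ℤP.≤-trans (hmin≤ x i<l l≤j) (ℤP.i≤i+j (h x l) (+ 1))

  module _ (x : Word) (dyck : Word → ℕ) where

    GDf-empty : ∀ f {i j} → j ∸ i ≡ 0 → GDf x dyck f i j ≡ 0
    GDf-empty zero    _ = refl
    GDf-empty (suc f) j∸i≡0 rewrite j∸i≡0 = refl

    GDf-fuel : ∀ f f′ i j → j ∸ i ≤ f → j ∸ i ≤ f′ → GDf x dyck f i j ≡ GDf x dyck f′ i j
    GDf-fuel zero f′ i j le _ = sym (GDf-empty f′ {i} {j} (n≤0⇒n≡0 le))
    GDf-fuel (suc f) zero i j _ le′ = GDf-empty (suc f) {i} {j} (n≤0⇒n≡0 le′)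
    GDf-fuel (suc f) (suc f′) i j le le′ with j ∸ i in eq
    ... | zero = refl
    ... | suc zero = refl
    ... | suc (suc d) = if-⊓-cong refl splits≡ nest≡
      where
        j∸i≤ : j ∸ i ≤ suc f
        j∸i≤ = ≡.subst (_≤ suc f) (sym eq) le
        j∸i≤′ : j ∸ i ≤ suc f′
        j∸i≤′ = ≡.subst (_≤ suc f′) (sym eq) le′
        splits≡ : minOver {T} (map (λ k → GDf x dyck f i k + GDf x dyck f k j) (splits x i j))
                ≡ minOver {T} (map (λ k → GDf x dyck f′ i k + GDf x dyck f′ k j) (splits x i j))
        splits≡ = cong (minOver {T}) (map-cong-local (All.tabulate λ {k} k∈ →
          let i<k , k<j = ∈-splits⁻ x k∈ in cong₂ _+_
          (GDf-fuel f f′ i k (left-part≤ i<k k<j j∸i≤) (left-part≤ i<k k<j j∸i≤′))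
          (GDf-fuel f f′ k j (right-part≤ i<k k<j j∸i≤) (right-part≤ i<k k<j j∸i≤′))))
        nest≡ : GDf x dyck f (suc i) (j ∸ 1) + dyck (sub x i (suc i) ++ sub x (j ∸ 1) j)
              ≡ GDf x dyck f′ (suc i) (j ∸ 1) + dyck (sub x i (suc i) ++ sub x (j ∸ 1) j)
        nest≡ = cong (_+ dyck (sub x i (suc i) ++ sub x (j ∸ 1) j))
          (GDf-fuel f f′ (suc i) (j ∸ 1) (inner-part≤ {i} {j} j∸i≤) (inner-part≤ {i} {j} j∸i≤′))

    splitCost : ℕ → ℕ → ℕ
    splitCost i j = minOver {T} (map (λ k → GD x dyck i k + GD x dyck k j) (splits x i j))

    nestCost : ℕ → ℕ → ℕ
    nestCost i j = GD x dyck (suc i) (j ∸ 1) + dyck (sub x i (suc i) ++ sub x (j ∸ 1) j)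

    nestable : ℕ → ℕ → Bool
    nestable i j = ⌊ hmin x i j ℤ.<? hmin x (suc i) (j ∸ 1) ⌋

    GDf-unfold : ∀ f → 2 ≤ j ∸ i → j ∸ i ≤ suc f →
                 GDf x dyck (suc f) i j ≡ (if nestable i j then splitCost i j ⊓ nestCost i j else splitCost i j)
    GDf-unfold {j} {i} f 2≤ le with j ∸ i in eq
    GDf-unfold f ()             _ | zero
    GDf-unfold f (s≤s ())       _ | suc zero
    -- The with-abstraction replaced j ∸ i by suc (suc d) in the statement but not in the unfolded GDf.
    ... | suc (suc d) = if-⊓-cong (cong (λ w → ⌊ hminAux x i w ℤ.<? hmin x (suc i) (j ∸ 1) ⌋) eq) splits≡ nest≡
      where
        j∸i≤ : j ∸ i ≤ suc f
        j∸i≤ = ≡.subst (_≤ suc f) (sym eq) le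
        splits≡ : minOver {T} (map (λ k → GDf x dyck f i k + GDf x dyck f k j) (splits x i j)) ≡ splitCost i j
        splits≡ = cong (minOver {T}) (map-cong-local (All.tabulate λ {k} k∈ →
          let i<k , k<j = ∈-splits⁻ x k∈ in cong₂ _+_
          (GDf-fuel f (k ∸ i) i k (left-part≤ i<k k<j j∸i≤) ≤-refl)
          (GDf-fuel f (j ∸ k) k j (right-part≤ i<k k<j j∸i≤) ≤-refl)))
        nest≡ : GDf x dyck f (suc i) (j ∸ 1) + dyck (sub x i (suc i) ++ sub x (j ∸ 1) j) ≡ nestCost i j
        nest≡ = cong (_+ dyck (sub x i (suc i) ++ sub x (j ∸ 1) j))
          (GDf-fuel f (j ∸ 1 ∸ suc i) (suc i) (j ∸ 1) (inner-part≤ {i} {j} j∸i≤) ≤-refl)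

    GD-unfold : suc i < j → GD x dyck i j ≡ (if nestable i j then splitCost i j ⊓ nestCost i j else splitCost i j)
    GD-unfold {i} {j} i+1<j =
      trans (GDf-fuel (j ∸ i) (suc (j ∸ i)) i j ≤-refl (n≤1+n _)) (GDf-unfold {j} {i} (j ∸ i) (2≤∸ i+1<j) (n≤1+n _))

    GD-empty : ∀ i → GD x dyck i i ≡ 0
    GD-empty i = GDf-empty (i ∸ i) (n∸n≡0 i)

    GD-letter : ∀ i → GD x dyck i (suc i) ≡ 1
    GD-letter i rewrite suc∸≡1 i | suc∸≡1 i = refl

    GD≤splitCost : suc i < j → GD x dyck i j ≤ splitCost i j
    GD≤splitCost {i} {j} i+1<j = ≤-trans (≤-reflexive (GD-unfold i+1<j)) (if-⊓≤ (nestable i j) _ _)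

    GD≤split : suc i < j → k ∈ splits x i j → GD x dyck i j ≤ GD x dyck i k + GD x dyck k j
    GD≤split {i} {j} i+1<j k∈ = ≤-trans (GD≤splitCost i+1<j) (minOver-≤ (λ k → GD x dyck i k + GD x dyck k j) k∈)

    GD≤nest : suc i < j → hmin x i j ℤ.< hmin x (suc i) (j ∸ 1) → GD x dyck i j ≤ nestCost i j
    GD≤nest {i} {j} i+1<j nests =
      ≤-trans (≤-reflexive (GD-unfold i+1<j)) (if-true-⊓≤ (splitCost i j) _ (fromWitness nests))

    GD-attained : suc i < j → (∃[ k ] k ∈ splits x i j × GD x dyck i j ≡ GD x dyck i k + GD x dyck k j)
                              ⊎ GD x dyck i j ≡ nestCost i j
    GD-attained {i} {j} i+1<j
      with k , k∈ , attained ← minOver-attained (λ k → GD x dyck i k + GD x dyck k j)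
                                                 (∈-splits⁺ x (allowed-first x) ≤-refl i+1<j)
      with if-⊓-sel (nestable i j) (splitCost i j) (nestCost i j)
    ... | inj₁ eq = inj₁ (k , k∈ , trans (GD-unfold i+1<j) (trans eq attained))
    ... | inj₂ eq = inj₂ (trans (GD-unfold i+1<j) eq)

    GD-peelʳ : i ≤ j → GD x dyck i (suc j) ≤ GD x dyck i j + 1
    GD-peelʳ {i} {j} i≤j with m≤n⇒m<n∨m≡n i≤j
    ... | inj₂ refl rewrite GD-letter i | GD-empty i = ≤-refl
    ... | inj₁ i<j = ≤-trans (GD≤split (s≤s i<j) (∈-splits⁺ x (allowed-last x {i} {suc j}) i<j ≤-refl))
                             (≤-reflexive (cong (λ s → GD x dyck i j + s) (GD-letter j)))

    GD-peelˡ : suc i < j → GD x dyck i j ≤ 1 + GD x dyck (suc i) j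
    GD-peelˡ {i} {j} i+1<j = ≤-trans (GD≤split i+1<j (∈-splits⁺ x (allowed-first x) ≤-refl i+1<j))
                                     (≤-reflexive (cong (_+ GD x dyck (suc i) j) (GD-letter i)))

    GD-peel : suc i ≤ j → GD x dyck i (suc j) ≤ 2 + GD x dyck (suc i) j
    GD-peel {i} {j} i<j = ≤-trans (GD-peelˡ (s≤s i<j)) (≤-trans (+-monoʳ-≤ 1 (GD-peelʳ i<j))
                                                              (≤-reflexive (cong suc (+-comm _ 1))))

    module _ (isDyck : ∀ y → IsDyckDist y (dyck y)) where

      GD-realised : Acc _<_ (j ∸ i) → i ≤ j → j ≤ length x → ∃[ c ] Parse x i j c × c ≤ GD x dyck i j
      GD-realised {j} {i} (acc rec) i≤j j≤n with m≤n⇒m<n∨m≡n i≤j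
      ... | inj₂ refl = 0 , empty , z≤n
      ... | inj₁ i<j with m≤n⇒m<n∨m≡n i<j
      ...   | inj₂ refl = 1 , delete , ≤-reflexive (sym (GD-letter i))
      ...   | inj₁ i+1<j@(s≤s i<j′) with GD-attained i+1<j
      ...     | inj₁ (k , k∈ , GD≡)
        with i<k , k<j ← ∈-splits⁻ x k∈
        with c₁ , t₁ , l₁ ← GD-realised (rec (∸-monoˡ-< k<j (<⇒≤ i<k))) (<⇒≤ i<k) (≤-trans (<⇒≤ k<j) j≤n)
           | c₂ , t₂ , l₂ ← GD-realised (rec (∸-monoʳ-< i<k (<⇒≤ k<j))) (<⇒≤ k<j) j≤n
        = _ , t₁ ⊕ t₂ , ≤-trans (+-mono-≤ l₁ l₂) (≤-reflexive (sym GD≡))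
      GD-realised {suc j′} {i} (acc rec) i≤j j≤n | inj₁ i<j | inj₁ (s≤s i<j′) | inj₂ GD≡
        with α , xα ← letter-exists x (≤-trans (s≤s (<⇒≤ i<j′)) j≤n) | β , xβ ← letter-exists x j≤n
        with e , p , e≤ ← dyckDist-pair-cost (isDyck (α ∷ β ∷ []))
        with c , t , l ← GD-realised (rec (inner< i<j′)) i<j′ (≤-trans (n≤1+n _) j≤n)
        = c + e , nest xα xβ p t ,
          ≤-trans (+-mono-≤ l e≤) (≤-reflexive (sym (trans GD≡ (cong (λ u → GD x dyck (suc i) j′ + dyck u) (cong₂ _++_ xα xβ)))))

  module _ (x : Word) (dyck : Word → ℕ) (isDyck : ∀ y → IsDyckDist y (dyck y)) where

    potential : ℕ → ℕ → ℤ
    potential i j = + GD x dyck i j ℤ.+ excess x i j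

    potential-split : suc i < j → k ∈ splits x i j → potential i j ℤ.≤ potential i k ℤ.+ potential k j
    potential-split {i} {j} {k} i+1<j k∈ with i<k , k<j ← ∈-splits⁻ x {i = i} {j} k∈ = begin
      + GD x dyck i j ℤ.+ excess x i j
        ≤⟨ ℤP.+-mono-≤ (ℕ≤⇒ℤ≤ {n = GD x dyck i k} (GD≤split x dyck i+1<j k∈)) (excess-superadditive x (<⇒≤ i<k) (<⇒≤ k<j)) ⟩
      + GD x dyck i k ℤ.+ + GD x dyck k j ℤ.+ (excess x i k ℤ.+ excess x k j)
        ≡⟨ interchange (+ GD x dyck i k) (+ GD x dyck k j) (excess x i k) (excess x k j) ⟩
      potential i k ℤ.+ potential k j ∎
      where
        open ℤP.≤-Reasoning
        interchange : ∀ a b c d → a ℤ.+ b ℤ.+ (c ℤ.+ d) ≡ a ℤ.+ c ℤ.+ (b ℤ.+ d)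
        interchange = ℤ-Solver.solve-∀

    module _ {i j} (i<j : suc i ≤ j) (xα : x [ i ]= α) (xβ : x [ j ]= β) (p : PairCost α β e) where
      private
        μ  = hmin x i (suc j)
        μ′ = hmin x (suc i) j
        s  = sign β ℤ.- sign α
        δ  = μ′ ℤ.- μ

      GD+excess-increment≤ : + GD x dyck i (suc j) ℤ.+ (s ℤ.+ (δ ℤ.+ δ)) ℤ.≤ + GD x dyck (suc i) j ℤ.+ + (3 * e)
      GD+excess-increment≤ with μ ℤ.<? μ′
      ... | yes μ<μ′ =
        nest-arith-nestable (+ GD x dyck i (suc j)) (+ GD x dyck (suc i) j) e s δ (ℕ≤⇒ℤ≤ {k = e} GD≤) δ≤1 (pairCost-sign p)
        where
          GD≤ : GD x dyck i (suc j) ≤ GD x dyck (suc i) j + e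
          GD≤ = ≤-trans (GD≤nest x dyck (s≤s i<j) μ<μ′) (+-monoʳ-≤ _ (≤-trans (≤-reflexive (cong dyck (cong₂ _++_ xα xβ)))
                        (dyckDist-pair≤ (isDyck _) p)))
          δ≤1 : δ ℤ.≤ + 1
          δ≤1 = -1≤⇒-≤1 {μ′} {μ} (hmin-inner-1≤ x xα xβ i<j)
      ... | no μ≮μ′ =
        nest-arith-flat (+ GD x dyck i (suc j)) (+ GD x dyck (suc i) j) e s δ (ℕ≤⇒ℤ≤ {n = 2} (GD-peel x dyck i<j)) δ≤0 (pairCost-sign p)
        where
          δ≤0 : δ ℤ.≤ + 0
          δ≤0 = ℤP.i≤j⇒i-j≤0 (ℤP.≮⇒≥ μ≮μ′)

      potential-nest : potential i (suc j) ℤ.≤ potential (suc i) j ℤ.+ + (3 * e)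
      potential-nest = begin
        + GD x dyck i (suc j) ℤ.+ excess x i (suc j)
          ≡⟨ cong (λ E → + GD x dyck i (suc j) ℤ.+ E) (excess-nest x xα xβ) ⟩
        + GD x dyck i (suc j) ℤ.+ (excess x (suc i) j ℤ.+ s ℤ.+ (δ ℤ.+ δ))
          ≡⟨ regroup (+ GD x dyck i (suc j)) (excess x (suc i) j) s δ ⟩
        + GD x dyck i (suc j) ℤ.+ (s ℤ.+ (δ ℤ.+ δ)) ℤ.+ excess x (suc i) j
          ≤⟨ ℤP.+-monoˡ-≤ (excess x (suc i) j) GD+excess-increment≤ ⟩
        + GD x dyck (suc i) j ℤ.+ + (3 * e) ℤ.+ excess x (suc i) j
          ≡⟨ regroup′ (+ GD x dyck (suc i) j) (+ (3 * e)) (excess x (suc i) j) ⟩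
        potential (suc i) j ℤ.+ + (3 * e) ∎
        where
          open ℤP.≤-Reasoning
          regroup : ∀ g E s d → g ℤ.+ (E ℤ.+ s ℤ.+ (d ℤ.+ d)) ≡ g ℤ.+ (s ℤ.+ (d ℤ.+ d)) ℤ.+ E
          regroup = ℤ-Solver.solve-∀
          regroup′ : ∀ g t E → g ℤ.+ t ℤ.+ E ≡ g ℤ.+ E ℤ.+ t
          regroup′ = ℤ-Solver.solve-∀

    potential≤3*cost : Acc _<_ (j ∸ i) → Parse x i j c → j ≤ length x → potential i j ℤ.≤ + (3 * c)
    potential≤3*cost {j} {i} {c} (acc rec) t j≤n with m≤n⇒m<n∨m≡n (parse-≤ x t)
    ... | inj₂ refl rewrite GD-empty x dyck i | excess-empty x i = ℤ.+≤+ z≤n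
    ... | inj₁ i<j with m≤n⇒m<n∨m≡n i<j
    ...   | inj₂ refl with _ , xα ← letter-exists x j≤n =
            ℤP.≤-trans (ℤP.≤-reflexive (cong₂ ℤ._+_ (cong +_ (GD-letter x dyck i)) (excess-letter x {i = i} xα)))
                       (ℤ.+≤+ (≤-trans (s≤s (s≤s z≤n)) (*-monoʳ-≤ 3 (parse-letter-cost x t))))
    ...   | inj₁ i+1<j with allowed-root x t i+1<j j≤n
    ...     | split {k = k} {c′ = a} {c″ = b} ok i<k k<j t₁ t₂ a+b≤c = begin
              potential i j                      ≤⟨ potential-split i+1<j (∈-splits⁺ x ok i<k k<j) ⟩
              potential i k ℤ.+ potential k j    ≤⟨ ℤP.+-mono-≤ left right ⟩
              + (3 * a) ℤ.+ + (3 * b)            ≤⟨ 3*-mono {a} {b} a+b≤c ⟩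
              + (3 * c)                          ∎
      where
        open ℤP.≤-Reasoning
        left = potential≤3*cost (rec (∸-monoˡ-< k<j (<⇒≤ i<k))) t₁ (≤-trans (<⇒≤ k<j) j≤n)
        right = potential≤3*cost (rec (∸-monoʳ-< i<k (<⇒≤ k<j))) t₂ j≤n
    ...     | nest {j = j′} {e = e} {c′ = a} xα xβ p t′ a+e≤c = begin
              potential i j                      ≤⟨ potential-nest (parse-≤ x t′) xα xβ p ⟩
              potential (suc i) j′ ℤ.+ + (3 * e) ≤⟨ ℤP.+-monoˡ-≤ (+ (3 * e)) inner ⟩
              + (3 * a) ℤ.+ + (3 * e)            ≤⟨ 3*-mono {a} {e} a+e≤c ⟩
              + (3 * c)                          ∎
      where
        open ℤP.≤-Reasoning
        inner = potential≤3*cost (rec (inner< (parse-≤ x t′))) t′ (≤-trans (n≤1+n _) j≤n)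

lemma4p2 : {T : Set} (x : List (Paren T)) (dyck : List (Paren T) → ℕ) →
    (∀ y → IsDyckDist y (dyck y)) →
    ∀ i j → i ≤ j → j ≤ length x →
    (dyck (sub x i j) ≤ GD x dyck i j) ×
    ((+ GD x dyck i j) ℤ.≤ ((+ 3) ℤ.* (+ dyck (sub x i j)) ℤ.- h x i ℤ.- h x j ℤ.+ (+ 2) ℤ.* hmin x i j))
lemma4p2 x dyck isDyck i j i≤j j≤n = lower , upper
  where
    lower : dyck (sub x i j) ≤ GD x dyck i j
    lower with c , t , c≤GD ← GD-realised x dyck isDyck (<-wellFounded (j ∸ i)) i≤j j≤n
          with w , dw , ew ← parse⇒edit x t j≤n
          = ≤-trans (proj₂ (isDyck (sub x i j)) w c dw ew) c≤GD
    upper : + GD x dyck i j ℤ.≤ + 3 ℤ.* + dyck (sub x i j) ℤ.- h x i ℤ.- h x j ℤ.+ + 2 ℤ.* hmin x i j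
    upper with w , dw , ew ← proj₁ (isDyck (sub x i j))
          with c , t , c≤D ← edit⇒parse x dw ew refl i≤j j≤n
          = isolate-GD (potential≤3*cost x dyck isDyck (<-wellFounded (j ∸ i)) t j≤n) c≤D
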